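{- For every $\ell\in\mathbb{N}$, $\delta\in(0,1)$ and $C\in\mathbb{N}$ there exist constants $\gamma,c\in(0,1)$ such that the following is true for every large enough $n$. Let $T$ be a tree on $n$ vertices with maximum degree $\Delta(T)\le\frac{cn}{\log(n)}$, and let $L(T)$ denote the set of leaves of $T$. Then at least one of the following holds: (i) $T$ has at least $\gamma n$ vertex-disjoint bare paths of length $\ell$; (ii) $|L(T)|\ge C\gamma n$ and there is a tree $T'\subset T$ with $v(T')\le\delta n$ and $|V(T')\cap N_T(L(T))|\ge C\log(n)$.
   Context: A leaf is a vertex of degree $1$. A path $P$ in $T$ is a bare path if all of its inner vertices have degree $2$ in $T$; its length is its number of edges. For $A\subset V(T)$, $N_T(A)=\left(\bigcup_{v\in A}N_T(v)\right)\setminus A$. $T'\subset T$ means $T'$ is a subgraph of $T$; $v(T')$ is its number of vertices. $\log$ is the natural logarithm.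
   Formalization: The parameter δ ranges over the rationals in $(0,1)$, and the constants γ and c are taken in the rationals. -}

module Defs where

open import Data.Nat as ℕ using (ℕ; zero; suc; _⊔_; _≡ᵇ_; _^_)
open import Data.Integer using (+_)
open import Data.Rational using (ℚ; _/_; _+_; _*_; _≤_; _<_; 0ℚ; 1ℚ)
open import Data.Bool using (Bool; true; false; T; not; _∧_)
open import Data.Fin using (Fin; toℕ; inject₁) renaming (suc to fsuc)
open import Data.List using (List; []; _∷_; allFin; foldr; map)
open import Data.Bool.ListAction using (any)
open import Data.Product using (Σ; ∃; _×_; _,_)
open import Data.Empty using (⊥)
open import Relation.Binary.PropositionalEquality using (_≡_)
open import Function.Definitions using (Injective)

ℕ→ℚ : ℕ → ℚ
ℕ→ℚ n = (+ n) / 1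

countB : {A : Set} → (A → Bool) → List A → ℕ
countB p [] = 0
countB p (x ∷ xs) with p x
... | true  = suc (countB p xs)
... | false = countB p xs

record Graph (n : ℕ) : Set where
  field
    adj    : Fin n → Fin n → Bool
    sym    : ∀ u v → adj u v ≡ adj v u
    irrefl : ∀ v → adj v v ≡ false

open Graph public

Edge : ∀ {n} → Graph n → Fin n → Fin n → Set
Edge G u v = T (adj G u v)

degree : ∀ {n} → Graph n → Fin n → ℕ
degree {n} G v = countB (adj G v) (allFin n)

maxDegree : ∀ {n} → Graph n → ℕ
maxDegree {n} G = foldr _⊔_ 0 (map (degree G) (allFin n))

data Walk {n : ℕ} (G : Graph n) : Fin n → Fin n → Set where
  here : ∀ v → Walk G v v
  step : ∀ {u v w} → Edge G u v → Walk G v w → Walk G u w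

Connected : ∀ {n} → Graph n → Set
Connected G = ∀ u v → Walk G u v

-- a cycle of length k+3: distinct vertices c 0,…,c (k+2), consecutive
-- ones adjacent and c (k+2) adjacent to c 0
record Cycle {n : ℕ} (G : Graph n) : Set where
  field
    k     : ℕ
    c     : Fin (suc (suc (suc k))) → Fin n
    inj   : Injective _≡_ _≡_ c
    edges : ∀ (i : Fin (suc (suc k))) → Edge G (c (inject₁ i)) (c (fsuc i))
    close : Edge G (c (Data.Fin.fromℕ (suc (suc k)))) (c Data.Fin.zero)

Acyclic : ∀ {n} → Graph n → Set
Acyclic G = Cycle G → ⊥

record Tree (n : ℕ) : Set where
  field
    graph     : Graph n
    connected : Connected graph
    acyclic   : Acyclic graph

open Tree public

isLeaf : ∀ {n} → Graph n → Fin n → Bool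
isLeaf G v = degree G v ≡ᵇ 1

inNbrLeaves : ∀ {n} → Graph n → Fin n → Bool
inNbrLeaves {n} G v =
  not (isLeaf G v) ∧ any (λ u → isLeaf G u ∧ adj G u v) (allFin n)

numLeaves : ∀ {n} → Graph n → ℕ
numLeaves {n} G = countB (isLeaf G) (allFin n)

record BarePath {n : ℕ} (G : Graph n) (ℓ : ℕ) (p : Fin (suc ℓ) → Fin n) : Set where
  field
    inj   : Injective _≡_ _≡_ p
    edges : ∀ (i : Fin ℓ) → Edge G (p (inject₁ i)) (p (fsuc i))
    inner : ∀ (i : Fin (suc ℓ)) → 0 ℕ.< toℕ i → toℕ i ℕ.< ℓ → degree G (p i) ≡ 2

record DisjointBarePaths {n : ℕ} (G : Graph n) (ℓ k : ℕ) : Set where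
  field
    path     : Fin k → Fin (suc ℓ) → Fin n
    bare     : ∀ a → BarePath G ℓ (path a)
    disjoint : ∀ a b i j → path a i ≡ path b j → a ≡ b

-- Subtrees: T' ⊂ T given as a tree on Fin m with an injective map into
-- V(T) sending edges of T' to edges of T

record Subtree {n : ℕ} (G : Graph n) (m : ℕ) : Set where
  field
    tree  : Tree m
    emb   : Fin m → Fin n
    inj   : Injective _≡_ _≡_ emb
    hom   : ∀ i j → Edge (graph tree) i j → Edge G (emb i) (emb j)

subtreeNL : ∀ {n m} {G : Graph n} → Subtree G m → ℕ
subtreeNL {n} {m} {G} S =
  countB (λ i → inNbrLeaves G (Subtree.emb S i)) (allFin m)

-- The exponential function on ℚ via its partial sums, and comparison
-- "m ≤ e^q" for m ∈ ℕ and q ≥ 0 (where the partial sums increase to e^q)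

expTerm : ℚ → ℕ → ℚ
expTerm q zero    = 1ℚ
expTerm q (suc k) = expTerm q k * q * ((+ 1) / suc k)

expPartial : ℚ → ℕ → ℚ
expPartial q zero    = 0ℚ
expPartial q (suc K) = expPartial q K + expTerm q K

LeExp : ℕ → ℚ → Set
LeExp m q = ∀ (ε : ℚ) → 0ℚ < ε → ∃ λ K → ℕ→ℚ m ≤ expPartial q K + ε

-- a · log n ≤ q   ⇔   n^a ≤ e^q
MulLogLe : ℕ → ℕ → ℚ → Set
MulLogLe a n q = LeExp (n ^ a) q

-- Root T at a vertex. A vertex of depth > ℓ whose ℓ nearest ancestors each have exactly one
-- child is the bottom of a bare path of length ℓ going up, and vertices whose depths agree
-- modulo ℓ + 1 give pairwise disjoint such paths. So either one residue class yields γ n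
-- disjoint bare paths, or few vertices start bare paths. In the second case let t be a deepest
-- vertex whose subtree has more than 2A vertices (A = n / 4(q+1), where 1/(q+1) ≤ δ), and let
-- T′ be t together with the subtrees of its first few children, so that A < v(T′) ≤ 3A + 1 ≤ δ n.
-- A vertex of T′ starting no bare path lies at distance < ℓ below t or below a vertex that is
-- the root or does not have exactly one child, and in a tree the children of branching vertices
-- number at most twice the leaves; hence T′ contains Ω(n) leaves of T. Each of them hangs from
-- the root or from a vertex of V(T′) ∩ N_T(L(T)), which carries at most Δ leaves, so
-- |V(T′) ∩ N_T(L(T))| = Ω(n / Δ) ≥ C log n since Δ log n ≤ c n. The hypothesis n^Δ ≤ e^(cn)
-- is used through the partial sums of the exponential series at y ≥ cn, which are ≤ 2·16^y.
module Submission where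

open import Data.Nat using (ℕ)
open import Data.Fin using (Fin)
open import Defs using (Tree)

module Counting where

  open import Data.Nat using (ℕ; zero; suc; _+_; _*_; _≤_; _<_; z≤n; s≤s; _⊔_)
  open import Data.Nat.Properties hiding (_≟_; suc-injective)
  open import Data.Bool using (Bool; true; false; T; not; _∧_; _∨_)
  open import Data.Fin using (Fin) renaming (zero to fzero; suc to fsuc)
  open import Data.Fin.Properties using (_≟_; suc-injective; injective⇒≤; any?)
  open import Data.List using (tabulate; allFin; foldr; map)
  open import Data.Bool.ListAction using (any)
  open import Data.Product using (Σ; ∃; _×_; _,_; proj₁; proj₂)
  open import Data.Sum using (_⊎_; inj₁; inj₂)
  open import Data.Empty using (⊥-elim)
  open import Data.Unit using (tt)
  open import Relation.Nullary using (¬_; yes; no; does)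
  open import Relation.Nullary.Decidable using (T?)
  open import Relation.Binary.PropositionalEquality
  open import Defs using (countB)

  ∧-elim : ∀ {a b} → T (a ∧ b) → T a × T b
  ∧-elim {true} {true} _ = tt , tt

  ∧-intro : ∀ {a b} → T a → T b → T (a ∧ b)
  ∧-intro {true} {true} _ _ = tt

  ∨-elim : ∀ {a b} → T (a ∨ b) → T a ⊎ T b
  ∨-elim {true} _ = inj₁ tt
  ∨-elim {false} {true} _ = inj₂ tt

  ∨-introˡ : ∀ {a b} → T a → T (a ∨ b)
  ∨-introˡ {true} _ = tt

  ∨-introʳ : ∀ {a b} → T b → T (a ∨ b)
  ∨-introʳ {true} _ = tt
  ∨-introʳ {false} {true} _ = tt

  not-intro : ∀ {a} → ¬ T a → T (not a)
  not-intro {false} _ = tt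
  not-intro {true} h = h tt

  not-elim : ∀ {a} → T (not a) → ¬ T a
  not-elim {false} _ ()

  T-≡true : ∀ {a} → a ≡ true → T a
  T-≡true refl = tt

  T⇒≡true : ∀ {a} → T a → a ≡ true
  T⇒≡true {true} _ = refl

  ¬T⇒≡false : ∀ {a} → ¬ T a → a ≡ false
  ¬T⇒≡false {false} _ = refl
  ¬T⇒≡false {true} h = ⊥-elim (h tt)

  χ : Bool → ℕ
  χ true = 1
  χ false = 0

  χ-true : ∀ {b} → T b → χ b ≡ 1
  χ-true {true} _ = refl

  χ-false : ∀ {b} → ¬ T b → χ b ≡ 0
  χ-false {false} _ = refl
  χ-false {true} h = ⊥-elim (h tt)

  χ-mono : ∀ {a b} → (T a → T b) → χ a ≤ χ b
  χ-mono {false} h = z≤n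
  χ-mono {true} {true} h = s≤s z≤n
  χ-mono {true} {false} h = ⊥-elim (h tt)

  χ-* : ∀ a b → χ a * χ b ≡ χ (b ∧ a)
  χ-* true true = refl
  χ-* true false = refl
  χ-* false true = refl
  χ-* false false = refl

  infix 4 _==_
  _==_ : ∀ {n} → Fin n → Fin n → Bool
  a == b = does (a ≟ b)

  ==⇒≡ : ∀ {n} {a b : Fin n} → T (a == b) → a ≡ b
  ==⇒≡ {a = a} {b} h with a ≟ b
  ... | yes p = p

  ≡⇒== : ∀ {n} {a b : Fin n} → a ≡ b → T (a == b)
  ≡⇒== {a = a} {b} h with a ≟ b
  ... | yes _ = tt
  ... | no q = q h

  ==-refl : ∀ {n} (a : Fin n) → T (a == a)
  ==-refl a = ≡⇒== {a = a} {b = a} refl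

  ==-sym : ∀ {n} (a b : Fin n) → (a == b) ≡ (b == a)
  ==-sym a b with a ≟ b | b ≟ a
  ... | yes _ | yes _ = refl
  ... | no _ | no _ = refl
  ... | yes p | no q = ⊥-elim (q (sym p))
  ... | no p | yes q = ⊥-elim (p (sym q))

  ==-suc : ∀ {n} (a b : Fin n) → (fsuc a == fsuc b) ≡ (a == b)
  ==-suc a b with fsuc a ≟ fsuc b | a ≟ b
  ... | yes _ | yes _ = refl
  ... | no _ | no _ = refl
  ... | yes p | no q = ⊥-elim (q (suc-injective p))
  ... | no p | yes q = ⊥-elim (p (cong fsuc q))

  ∑ : ∀ {n} → (Fin n → ℕ) → ℕ
  ∑ {zero} f = 0
  ∑ {suc n} f = f fzero + ∑ (λ i → f (fsuc i))

  ∑-cong : ∀ {n} {f g : Fin n → ℕ} → (∀ i → f i ≡ g i) → ∑ f ≡ ∑ g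
  ∑-cong {zero} h = refl
  ∑-cong {suc n} h = cong₂ _+_ (h fzero) (∑-cong (λ i → h (fsuc i)))

  ∑-mono : ∀ {n} {f g : Fin n → ℕ} → (∀ i → f i ≤ g i) → ∑ f ≤ ∑ g
  ∑-mono {zero} h = z≤n
  ∑-mono {suc n} h = +-mono-≤ (h fzero) (∑-mono (λ i → h (fsuc i)))

  ∑-zero : ∀ {n} → ∑ {n} (λ _ → 0) ≡ 0
  ∑-zero {zero} = refl
  ∑-zero {suc n} = ∑-zero {n}

  ∑-const : ∀ {n} c → ∑ {n} (λ _ → c) ≡ n * c
  ∑-const {zero} c = refl
  ∑-const {suc n} c = cong (c +_) (∑-const {n} c)

  ∑-+ : ∀ {n} (f g : Fin n → ℕ) → ∑ (λ i → f i + g i) ≡ ∑ f + ∑ g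
  ∑-+ {zero} f g = refl
  ∑-+ {suc n} f g = begin
    f fzero + g fzero + ∑ (λ i → f (fsuc i) + g (fsuc i))
      ≡⟨ cong (f fzero + g fzero +_) (∑-+ (λ i → f (fsuc i)) (λ i → g (fsuc i))) ⟩
    f fzero + g fzero + (∑ (λ i → f (fsuc i)) + ∑ (λ i → g (fsuc i)))
      ≡⟨ +-comm-middle (f fzero) (g fzero) _ _ ⟩
    f fzero + ∑ (λ i → f (fsuc i)) + (g fzero + ∑ (λ i → g (fsuc i))) ∎
    where
    open ≡-Reasoning
    +-comm-middle : ∀ a b c d → a + b + (c + d) ≡ a + c + (b + d)
    +-comm-middle a b c d = begin
      a + b + (c + d) ≡⟨ +-assoc a b (c + d) ⟩
      a + (b + (c + d)) ≡⟨ cong (a +_) (+-comm b (c + d)) ⟩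
      a + ((c + d) + b) ≡⟨ cong (a +_) (+-assoc c d b) ⟩
      a + (c + (d + b)) ≡⟨ cong (λ z → a + (c + z)) (+-comm d b) ⟩
      a + (c + (b + d)) ≡⟨ +-assoc a c (b + d) ⟨
      a + c + (b + d) ∎

  ∑-*ˡ : ∀ {n} c (f : Fin n → ℕ) → ∑ (λ i → c * f i) ≡ c * ∑ f
  ∑-*ˡ {zero} c f = sym (*-zeroʳ c)
  ∑-*ˡ {suc n} c f = trans (cong (c * f fzero +_) (∑-*ˡ c (λ i → f (fsuc i))))
                          (sym (*-distribˡ-+ c (f fzero) _))

  ∑-swap : ∀ {n m} (f : Fin n → Fin m → ℕ) →
    ∑ (λ i → ∑ (λ j → f i j)) ≡ ∑ (λ j → ∑ (λ i → f i j))
  ∑-swap {zero} {m} f = sym (∑-zero {m})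
  ∑-swap {suc n} {m} f =
    trans (cong (∑ (λ j → f fzero j) +_) (∑-swap (λ i j → f (fsuc i) j)))
          (sym (∑-+ (λ j → f fzero j) (λ j → ∑ (λ i → f (fsuc i) j))))

  ∑-point : ∀ {n} (f : Fin n → ℕ) (a : Fin n) → f a ≤ ∑ f
  ∑-point f fzero = m≤m+n (f fzero) _
  ∑-point f (fsuc a) = ≤-trans (∑-point (λ i → f (fsuc i)) a) (m≤n+m _ (f fzero))

  ∑-bound : ∀ {n} (f : Fin n → ℕ) c → (∀ i → f i ≤ c) → ∑ f ≤ n * c
  ∑-bound {n} f c h = subst (∑ f ≤_) (∑-const {n} c) (∑-mono h)

  ∑-select : ∀ {n} (a : Fin n) (g : Fin n → ℕ) → ∑ (λ i → χ (i == a) * g i) ≡ g a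
  ∑-select {suc n} fzero g = begin
    χ (fzero == fzero {n}) * g fzero + ∑ (λ i → χ (fsuc i == fzero) * g (fsuc i))
      ≡⟨ cong₂ _+_ (cong (_* g fzero) (χ-true (==-refl (fzero {n}))))
                   (∑-cong (λ i → cong (_* g (fsuc i)) (χ-false (λ e → 0≢suc (==⇒≡ {a = fsuc i} {b = fzero} e))))) ⟩
    1 * g fzero + ∑ {n} (λ _ → 0)
      ≡⟨ cong₂ _+_ (*-identityˡ (g fzero)) (∑-zero {n}) ⟩
    g fzero + 0
      ≡⟨ +-identityʳ _ ⟩
    g fzero ∎
    where
    open ≡-Reasoning
    0≢suc : ∀ {i : Fin n} → fsuc i ≢ fzero
    0≢suc ()
  ∑-select {suc n} (fsuc a) g = begin
    χ (fzero == fsuc a) * g fzero + ∑ (λ i → χ (fsuc i == fsuc a) * g (fsuc i))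
      ≡⟨ cong₂ _+_ (cong (_* g fzero) (χ-false (λ e → 0≢suc (==⇒≡ e))))
                   (∑-cong (λ i → cong (λ b → χ b * g (fsuc i)) (==-suc i a))) ⟩
    ∑ (λ i → χ (i == a) * g (fsuc i))
      ≡⟨ ∑-select a (λ i → g (fsuc i)) ⟩
    g (fsuc a) ∎
    where
    open ≡-Reasoning
    0≢suc : fzero ≢ fsuc a
    0≢suc ()

  count : ∀ {n} → (Fin n → Bool) → ℕ
  count P = ∑ (λ i → χ (P i))

  count-mono : ∀ {n} {P Q : Fin n → Bool} → (∀ i → T (P i) → T (Q i)) → count P ≤ count Q
  count-mono h = ∑-mono (λ i → χ-mono (h i))

  count-cong : ∀ {n} {P Q : Fin n → Bool} →
    (∀ i → T (P i) → T (Q i)) → (∀ i → T (Q i) → T (P i)) → count P ≡ count Q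
  count-cong h₁ h₂ = ≤-antisym (count-mono h₁) (count-mono h₂)

  count-none : ∀ {n} {P : Fin n → Bool} → (∀ i → ¬ T (P i)) → count P ≡ 0
  count-none {n} h = trans (∑-cong (λ i → χ-false (h i))) (∑-zero {n})

  count-all : ∀ {n} → count {n} (λ _ → true) ≡ n
  count-all {n} = trans (∑-const {n} 1) (*-identityʳ n)

  count-point : ∀ {n} (P : Fin n → Bool) a → T (P a) → 1 ≤ count P
  count-point P a pa = subst (_≤ count P) (χ-true pa) (∑-point (λ i → χ (P i)) a)

  count-witness : ∀ {n} (P : Fin n → Bool) → 0 < count P → ∃ λ i → T (P i)
  count-witness {suc n} P h with P fzero in eq
  ... | true = fzero , T-≡true eq
  ... | false with count-witness (λ i → P (fsuc i)) h
  ... | i , pi = fsuc i , pi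

  count-≤1 : ∀ {n} (P : Fin n → Bool) → (∀ i j → T (P i) → T (P j) → i ≡ j) → count P ≤ 1
  count-≤1 {zero} P h = z≤n
  count-≤1 {suc n} P h with P fzero in eq
  ... | true = ≤-reflexive (cong suc (count-none (λ i pi → 0≢suc (h fzero (fsuc i) (T-≡true eq) pi))))
    where
    0≢suc : ∀ {i : Fin n} → fzero ≢ fsuc i
    0≢suc ()
  ... | false = count-≤1 (λ i → P (fsuc i)) (λ i j pi pj → suc-injective (h (fsuc i) (fsuc j) pi pj))

  count-== : ∀ {n} (a : Fin n) → count (_== a) ≡ 1
  count-== {n} a = trans (∑-cong (λ i → sym (*-identityʳ (χ (i == a))))) (∑-select a (λ _ → 1))

  count-∪ : ∀ {n} (P Q R : Fin n → Bool) →
    (∀ i → T (P i) → T (Q i) ⊎ T (R i)) → count P ≤ count Q + count R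
  count-∪ P Q R h = ≤-trans (∑-mono pointwise) (≤-reflexive (∑-+ (λ i → χ (Q i)) (λ i → χ (R i))))
    where
    pointwise : ∀ i → χ (P i) ≤ χ (Q i) + χ (R i)
    pointwise i with P i in e
    ... | false = z≤n
    ... | true with h i (T-≡true e)
    ... | inj₁ q = ≤-trans (≤-reflexive (sym (χ-true q))) (m≤m+n _ _)
    ... | inj₂ r = ≤-trans (≤-reflexive (sym (χ-true r))) (m≤n+m _ _)

  count-split : ∀ {n} (P Q : Fin n → Bool) →
    count P ≡ count (λ i → P i ∧ Q i) + count (λ i → P i ∧ not (Q i))
  count-split P Q = trans (∑-cong pointwise) (∑-+ (λ i → χ (P i ∧ Q i)) (λ i → χ (P i ∧ not (Q i))))
    where
    pointwise : ∀ i → χ (P i) ≡ χ (P i ∧ Q i) + χ (P i ∧ not (Q i))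
    pointwise i with P i | Q i
    ... | true | true = refl
    ... | true | false = refl
    ... | false | _ = refl

  2≤count : ∀ {n} (P : Fin n → Bool) a b → T (P a) → T (P b) → a ≢ b → 2 ≤ count P
  2≤count P a b pa pb a≢b = ≤-trans
    (+-mono-≤ (count-point _ a (∧-intro pa (==-refl a)))
              (count-point _ b (∧-intro pb (not-intro (λ e → a≢b (sym (==⇒≡ e)))))))
    (≤-reflexive (sym (count-split P (_== a))))

  count-≤-χ* : ∀ {n} (P : Fin n → Bool) b c →
    count P ≤ c → (∀ i → T (P i) → T b) → count P ≤ χ b * c
  count-≤-χ* P true c h₁ h₂ = subst (count P ≤_) (sym (+-identityʳ c)) h₁
  count-≤-χ* P false c h₁ h₂ = ≤-reflexive (count-none h₂)

  count-fibres : ∀ {n m} (P : Fin n → Bool) (f : Fin n → Fin m) →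
    count P ≡ ∑ (λ u → count (λ x → P x ∧ (f x == u)))
  count-fibres P f = begin
    count P
      ≡⟨ ∑-cong (λ x → sym (∑-select (f x) (λ _ → χ (P x)))) ⟩
    ∑ (λ x → ∑ (λ u → χ (u == f x) * χ (P x)))
      ≡⟨ ∑-swap (λ x u → χ (u == f x) * χ (P x)) ⟩
    ∑ (λ u → ∑ (λ x → χ (u == f x) * χ (P x)))
      ≡⟨ ∑-cong (λ u → ∑-cong (λ x → trans (χ-* (u == f x) (P x))
                                           (cong (λ b → χ (P x ∧ b)) (==-sym u (f x))))) ⟩
    ∑ (λ u → count (λ x → P x ∧ (f x == u))) ∎
    where open ≡-Reasoning

  count-cover : ∀ {n L} (P : Fin n → Bool) (Q : Fin L → Fin n → Bool) →
    (∀ v → T (P v) → ∃ λ j → T (Q j v)) → count P ≤ ∑ (λ j → count (Q j))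
  count-cover {L = zero} P Q h = ≤-reflexive (count-none (λ v pv → no-index (h v pv)))
    where
    no-index : ∀ {v} → ¬ ∃ (λ (j : Fin 0) → T (Q j v))
    no-index (() , _)
  count-cover {L = suc L} P Q h =
    ≤-trans (count-∪ P (Q fzero) P′ split)
            (+-monoʳ-≤ (count (Q fzero)) (count-cover P′ (λ j → Q (fsuc j)) h′))
    where
    P′ : _ → Bool
    P′ v = P v ∧ not (Q fzero v)
    split : ∀ v → T (P v) → T (Q fzero v) ⊎ T (P′ v)
    split v pv with Q fzero v
    ... | true = inj₁ tt
    ... | false = inj₂ (∧-intro pv tt)
    h′ : ∀ v → T (P′ v) → ∃ λ j → T (Q (fsuc j) v)
    h′ v p′v with ∧-elim p′v
    ... | pv , ¬q₀ with h v pv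
    ... | fzero , q = ⊥-elim (not-elim ¬q₀ q)
    ... | fsuc j , q = j , q

  enumerate : ∀ {n} (P : Fin n → Bool) → Fin (count P) → Fin n
  enumerate {suc n} P i with P fzero
  enumerate {suc n} P fzero | true = fzero
  enumerate {suc n} P (fsuc i) | true = fsuc (enumerate (λ j → P (fsuc j)) i)
  enumerate {suc n} P i | false = fsuc (enumerate (λ j → P (fsuc j)) i)

  enumerate-sound : ∀ {n} (P : Fin n → Bool) i → T (P (enumerate P i))
  enumerate-sound {suc n} P i with P fzero in eq
  enumerate-sound {suc n} P fzero | true = T-≡true eq
  enumerate-sound {suc n} P (fsuc i) | true = enumerate-sound (λ j → P (fsuc j)) i
  enumerate-sound {suc n} P i | false = enumerate-sound (λ j → P (fsuc j)) i

  enumerate-injective : ∀ {n} (P : Fin n → Bool) i j → enumerate P i ≡ enumerate P j → i ≡ j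
  enumerate-injective {suc n} P i j e with P fzero
  enumerate-injective {suc n} P fzero fzero e | true = refl
  enumerate-injective {suc n} P (fsuc i) (fsuc j) e | true =
    cong fsuc (enumerate-injective (λ k → P (fsuc k)) i j (suc-injective e))
  enumerate-injective {suc n} P i j e | false =
    enumerate-injective (λ k → P (fsuc k)) i j (suc-injective e)

  enumerate-complete : ∀ {n} (P : Fin n → Bool) v → T (P v) → Σ (Fin (count P)) λ i → enumerate P i ≡ v
  enumerate-complete {suc n} P v pv with P fzero in eq
  enumerate-complete {suc n} P fzero pv | true = fzero , refl
  enumerate-complete {suc n} P (fsuc v) pv | true with enumerate-complete (λ j → P (fsuc j)) v pv
  ... | i , e = fsuc i , cong fsuc e
  enumerate-complete {suc n} P fzero pv | false = ⊥-elim (subst T eq pv)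
  enumerate-complete {suc n} P (fsuc v) pv | false with enumerate-complete (λ j → P (fsuc j)) v pv
  ... | i , e = i , cong fsuc e

  count-∧-enumerate : ∀ {n} (P Q : Fin n → Bool) →
    count (λ v → P v ∧ Q v) ≡ count (λ i → Q (enumerate P i))
  count-∧-enumerate {zero} P Q = refl
  count-∧-enumerate {suc n} P Q with P fzero
  ... | true = cong (χ (Q fzero) +_) (count-∧-enumerate (λ j → P (fsuc j)) (λ j → Q (fsuc j)))
  ... | false = count-∧-enumerate (λ j → P (fsuc j)) (λ j → Q (fsuc j))

  count-injection : ∀ {n m} (P : Fin n → Bool) (Q : Fin m → Bool) (f : Fin n → Fin m) →
    (∀ i → T (P i) → T (Q (f i))) → (∀ i j → T (P i) → T (P j) → f i ≡ f j → i ≡ j) →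
    count P ≤ count Q
  count-injection P Q f f-maps f-inj = injective⇒≤ {f = g} g-injective
    where
    lift : ∀ i → Σ (Fin (count Q)) λ k → enumerate Q k ≡ f (enumerate P i)
    lift i = enumerate-complete Q _ (f-maps _ (enumerate-sound P i))
    g : Fin (count P) → Fin (count Q)
    g i = proj₁ (lift i)
    g-injective : ∀ {i j} → g i ≡ g j → i ≡ j
    g-injective {i} {j} e = enumerate-injective P i j
      (f-inj _ _ (enumerate-sound P i) (enumerate-sound P j)
        (trans (sym (proj₂ (lift i))) (trans (cong (enumerate Q) e) (proj₂ (lift j)))))

  countB-allFin : ∀ {n} (p : Fin n → Bool) → countB p (allFin n) ≡ count p
  countB-allFin p = go p (λ i → i)
    where
    go : ∀ {n} {A : Set} (p : A → Bool) (f : Fin n → A) → countB p (tabulate f) ≡ ∑ (λ i → χ (p (f i)))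
    go {zero} p f = refl
    go {suc n} p f with p (f fzero)
    ... | true = cong suc (go p (λ i → f (fsuc i)))
    ... | false = go p (λ i → f (fsuc i))

  any-allFin⁺ : ∀ {n} (p : Fin n → Bool) i → T (p i) → T (any p (allFin n))
  any-allFin⁺ p = go p (λ i → i)
    where
    go : ∀ {n} {A : Set} (p : A → Bool) (f : Fin n → A) i → T (p (f i)) → T (any p (tabulate f))
    go p f fzero h with p (f fzero)
    ... | true = tt
    go p f (fsuc i) h with p (f fzero)
    ... | true = tt
    ... | false = go p (λ j → f (fsuc j)) i h

  any-allFin⁻ : ∀ {n} (p : Fin n → Bool) → T (any p (allFin n)) → ∃ λ i → T (p i)
  any-allFin⁻ p = go p (λ i → i)
    where
    go : ∀ {n} {A : Set} (p : A → Bool) (f : Fin n → A) → T (any p (tabulate f)) → ∃ λ i → T (p (f i))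
    go {suc n} p f h with p (f fzero) in eq
    ... | true = fzero , T-≡true eq
    ... | false with go p (λ i → f (fsuc i)) h
    ... | i , q = fsuc i , q

  ≤-foldr-⊔-allFin : ∀ {n} (g : Fin n → ℕ) i → g i ≤ foldr _⊔_ 0 (map g (allFin n))
  ≤-foldr-⊔-allFin g = go g (λ j → j)
    where
    go : ∀ {n m} (g : Fin m → ℕ) (f : Fin n → Fin m) i → g (f i) ≤ foldr _⊔_ 0 (map g (tabulate f))
    go g f fzero = m≤m⊔n _ _
    go g f (fsuc i) = ≤-trans (go g (λ j → f (fsuc j)) i) (m≤n⊔m (g (f fzero)) _)

  least-< : (p : ℕ → Bool) (b : ℕ) →
    (Σ ℕ λ k → k < b × T (p k) × (∀ j → j < k → ¬ T (p j))) ⊎ (∀ j → j < b → ¬ T (p j))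
  least-< p zero = inj₂ (λ j ())
  least-< p (suc b) with least-< p b
  ... | inj₁ (k , k<b , pk , minimal) = inj₁ (k , m<n⇒m<1+n k<b , pk , minimal)
  ... | inj₂ none with p b in eq
  ... | true = inj₁ (b , n<1+n b , T-≡true eq , none)
  ... | false = inj₂ none′
    where
    none′ : ∀ j → j < suc b → ¬ T (p j)
    none′ j (s≤s j≤b) pj with m≤n⇒m<n∨m≡n j≤b
    ... | inj₁ j<b = none j j<b pj
    ... | inj₂ refl = subst T eq pj

  least-≤ : (p : ℕ → Bool) (b : ℕ) → T (p b) → Σ ℕ λ k → k ≤ b × T (p k) × (∀ j → j < k → ¬ T (p j))
  least-≤ p b pb with least-< p (suc b)
  ... | inj₁ (k , s≤s k≤b , pk , minimal) = k , k≤b , pk , minimal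
  ... | inj₂ none = ⊥-elim (none b (n<1+n b) pb)

  greatest-≤ : (p : ℕ → Bool) (b : ℕ) → T (p 0) →
    Σ ℕ λ k → k ≤ b × T (p k) × (∀ j → k < j → j ≤ b → ¬ T (p j))
  greatest-≤ p zero p0 = 0 , z≤n , p0 , λ j k<j j≤0 _ → <⇒≱ k<j j≤0
  greatest-≤ p (suc b) p0 with p (suc b) in eq
  ... | true = suc b , ≤-refl , T-≡true eq , λ j k<j j≤ _ → <⇒≱ k<j j≤
  ... | false with greatest-≤ p b p0
  ... | k , k≤b , pk , maximal = k , m≤n⇒m≤1+n k≤b , pk , maximal′
    where
    maximal′ : ∀ j → k < j → j ≤ suc b → ¬ T (p j)
    maximal′ j k<j j≤ pj with m≤n⇒m<n∨m≡n j≤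
    ... | inj₁ (s≤s j≤b) = maximal j k<j j≤b pj
    ... | inj₂ refl = subst T eq pj

  find : ∀ {n} → (Fin n → Bool) → Fin n → Fin n
  find P default with any? (λ i → T? (P i))
  ... | yes (i , _) = i
  ... | no _ = default

  find-sound : ∀ {n} (P : Fin n → Bool) default i → T (P i) → T (P (find P default))
  find-sound P default i pi with any? (λ i → T? (P i))
  ... | yes (_ , pj) = pj
  ... | no none = ⊥-elim (none (i , pi))

  find-default : ∀ {n} (P : Fin n → Bool) default → (∀ i → ¬ T (P i)) → find P default ≡ default
  find-default P default none with any? (λ i → T? (P i))
  ... | yes (i , pi) = ⊥-elim (none i pi)
  ... | no _ = refl

module Rationals where

  open import Data.Nat as ℕ using (ℕ; zero; suc)
  import Data.Nat.Properties as ℕP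
  open import Data.Integer as ℤ using (+_)
  import Data.Integer.Properties as ℤP
  open import Data.Rational using (ℚ; mkℚ; _/_; 0ℚ; 1ℚ; _≤_; _<_; _+_; _*_; *≤*; *<*; positive; nonNegative)
  open import Data.Rational.Properties
  open import Data.Rational.Solver using (module +-*-Solver)
  open import Data.Product using (∃; _,_)
  open import Data.Empty using (⊥-elim)
  import Data.Nat.Coprimality as Coprimality
  open import Relation.Binary.PropositionalEquality
  open import Defs using (ℕ→ℚ)

  1/suc : ℕ → ℚ
  1/suc k = (+ 1) / suc k

  private
    ℕ→ℚ-mkℚ : ∀ n → ℕ→ℚ n ≡ mkℚ (+ n) 0 (Coprimality.sym (Coprimality.1-coprimeTo n))
    ℕ→ℚ-mkℚ n = normalize-coprime (Coprimality.sym (Coprimality.1-coprimeTo n))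

    1/suc-mkℚ : ∀ k → 1/suc k ≡ mkℚ (+ 1) k (Coprimality.1-coprimeTo (suc k))
    1/suc-mkℚ k = normalize-coprime (Coprimality.1-coprimeTo (suc k))

  ℕ→ℚ-mono : ∀ {a b} → a ℕ.≤ b → ℕ→ℚ a ≤ ℕ→ℚ b
  ℕ→ℚ-mono {a} {b} h rewrite ℕ→ℚ-mkℚ a | ℕ→ℚ-mkℚ b =
    *≤* (subst₂ ℤ._≤_ (sym (ℤP.*-identityʳ (+ a))) (sym (ℤP.*-identityʳ (+ b))) (ℤ.+≤+ h))

  ℕ→ℚ-mono⁻¹ : ∀ {a b} → ℕ→ℚ a ≤ ℕ→ℚ b → a ℕ.≤ b
  ℕ→ℚ-mono⁻¹ {a} {b} h rewrite ℕ→ℚ-mkℚ a | ℕ→ℚ-mkℚ b with h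
  ... | *≤* q with subst₂ ℤ._≤_ (ℤP.*-identityʳ (+ a)) (ℤP.*-identityʳ (+ b)) q
  ... | ℤ.+≤+ r = r

  ℕ→ℚ-strictMono : ∀ {a b} → a ℕ.< b → ℕ→ℚ a < ℕ→ℚ b
  ℕ→ℚ-strictMono {a} {b} h rewrite ℕ→ℚ-mkℚ a | ℕ→ℚ-mkℚ b =
    *<* (subst₂ ℤ._<_ (sym (ℤP.*-identityʳ (+ a))) (sym (ℤP.*-identityʳ (+ b))) (ℤ.+<+ h))

  ℕ→ℚ-+ : ∀ a b → ℕ→ℚ (a ℕ.+ b) ≡ ℕ→ℚ a + ℕ→ℚ b
  ℕ→ℚ-+ a b rewrite ℕ→ℚ-mkℚ a | ℕ→ℚ-mkℚ b =
    sym (cong (_/ 1) (cong₂ ℤ._+_ (ℤP.*-identityʳ (+ a)) (ℤP.*-identityʳ (+ b))))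

  ℕ→ℚ-* : ∀ a b → ℕ→ℚ (a ℕ.* b) ≡ ℕ→ℚ a * ℕ→ℚ b
  ℕ→ℚ-* a b rewrite ℕ→ℚ-mkℚ a | ℕ→ℚ-mkℚ b = cong (_/ 1) (ℤP.pos-* a b)

  ℕ→ℚ-nonNeg : ∀ n → 0ℚ ≤ ℕ→ℚ n
  ℕ→ℚ-nonNeg n = ℕ→ℚ-mono {0} {n} ℕ.z≤n

  *-nonNeg : ∀ {p q} → 0ℚ ≤ p → 0ℚ ≤ q → 0ℚ ≤ p * q
  *-nonNeg {p} {q} 0≤p 0≤q =
    nonNegative⁻¹ (p * q) {{nonNeg*nonNeg⇒nonNeg p {{nonNegative 0≤p}} q {{nonNegative 0≤q}}}}

  *-mono-≤-nonNeg : ∀ {p p′ q q′} → 0ℚ ≤ p → p ≤ p′ → 0ℚ ≤ q → q ≤ q′ → p * q ≤ p′ * q′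
  *-mono-≤-nonNeg {p} {p′} {q} {q′} 0≤p p≤p′ 0≤q q≤q′ =
    ≤-trans (*-monoʳ-≤-nonNeg q {{nonNegative 0≤q}} p≤p′)
            (*-monoˡ-≤-nonNeg p′ {{nonNegative (≤-trans 0≤p p≤p′)}} q≤q′)

  ≤-+-nonNeg : ∀ {p q} → 0ℚ ≤ q → p ≤ p + q
  ≤-+-nonNeg {p} {q} 0≤q = subst (_≤ p + q) (+-identityʳ p) (+-monoʳ-≤ p 0≤q)

  *-cancelʳ-≤-ℕ : ∀ {p q} n → 0 ℕ.< n → p * ℕ→ℚ n ≤ q * ℕ→ℚ n → p ≤ q
  *-cancelʳ-≤-ℕ n 0<n = *-cancelʳ-≤-pos (ℕ→ℚ n) {{positive (ℕ→ℚ-strictMono 0<n)}}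

  1/suc-pos : ∀ k → 0ℚ < 1/suc k
  1/suc-pos k rewrite 1/suc-mkℚ k = *<* (ℤ.+<+ (ℕ.s≤s ℕ.z≤n))

  1/suc-nonNeg : ∀ k → 0ℚ ≤ 1/suc k
  1/suc-nonNeg k = <⇒≤ (1/suc-pos k)

  1/suc-<1 : ∀ k → 1/suc (suc k) < 1ℚ
  1/suc-<1 k rewrite 1/suc-mkℚ (suc k) = *<* (ℤ.+<+ (ℕ.s≤s (ℕ.s≤s ℕ.z≤n)))

  1/suc-inverse : ∀ k → 1/suc k * ℕ→ℚ (suc k) ≡ 1ℚ
  1/suc-inverse k rewrite 1/suc-mkℚ k | ℕ→ℚ-mkℚ (suc k) =
    *-inverseˡ (mkℚ (+ suc k) 0 (Coprimality.sym (Coprimality.1-coprimeTo (suc k))))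

  1/suc-*-ℕ : ∀ k y → 1/suc k * ℕ→ℚ (suc k ℕ.* y) ≡ ℕ→ℚ y
  1/suc-*-ℕ k y = begin
    1/suc k * ℕ→ℚ (suc k ℕ.* y)        ≡⟨ cong (1/suc k *_) (ℕ→ℚ-* (suc k) y) ⟩
    1/suc k * (ℕ→ℚ (suc k) * ℕ→ℚ y)    ≡⟨ *-assoc (1/suc k) _ _ ⟨
    1/suc k * ℕ→ℚ (suc k) * ℕ→ℚ y      ≡⟨ cong (_* ℕ→ℚ y) (1/suc-inverse k) ⟩
    1ℚ * ℕ→ℚ y                          ≡⟨ *-identityˡ _ ⟩
    ℕ→ℚ y                               ∎
    where open ≡-Reasoning

  1/suc-*-≤ : ∀ k x y → x ℕ.≤ suc k ℕ.* y → 1/suc k * ℕ→ℚ x ≤ ℕ→ℚ y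
  1/suc-*-≤ k x y h = subst (1/suc k * ℕ→ℚ x ≤_) (1/suc-*-ℕ k y)
    (*-monoˡ-≤-nonNeg (1/suc k) {{nonNegative (1/suc-nonNeg k)}} (ℕ→ℚ-mono h))

  ≤-1/suc-* : ∀ k x y → suc k ℕ.* y ℕ.≤ x → ℕ→ℚ y ≤ 1/suc k * ℕ→ℚ x
  ≤-1/suc-* k x y h = subst (_≤ 1/suc k * ℕ→ℚ x) (1/suc-*-ℕ k y)
    (*-monoˡ-≤-nonNeg (1/suc k) {{nonNegative (1/suc-nonNeg k)}} (ℕ→ℚ-mono h))

  *-1/suc-*-≤ : ∀ a k n m → a ℕ.* n ℕ.≤ suc k ℕ.* m → ℕ→ℚ a * 1/suc k * ℕ→ℚ n ≤ ℕ→ℚ m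
  *-1/suc-*-≤ a k n m h = subst (_≤ ℕ→ℚ m) (sym reassoc) (1/suc-*-≤ k (a ℕ.* n) m h)
    where
    open +-*-Solver
    reassoc : ℕ→ℚ a * 1/suc k * ℕ→ℚ n ≡ 1/suc k * ℕ→ℚ (a ℕ.* n)
    reassoc = trans (solve 3 (λ a u n → a :* u :* n := u :* (a :* n)) refl (ℕ→ℚ a) (1/suc k) (ℕ→ℚ n))
                    (cong (1/suc k *_) (sym (ℕ→ℚ-* a n)))

  1/suc-≤-pos : ∀ δ → 0ℚ < δ → ∃ λ k → 1/suc k ≤ δ
  1/suc-≤-pos (mkℚ (+ zero) _ _) 0<δ = ⊥-elim (ℤ.Positive.pos (positive 0<δ))
  1/suc-≤-pos (mkℚ ℤ.-[1+ _ ] _ _) 0<δ = ⊥-elim (ℤ.Positive.pos (positive 0<δ))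
  1/suc-≤-pos (mkℚ (+ suc p) k c) 0<δ = k , subst (_≤ mkℚ (+ suc p) k c) (sym (1/suc-mkℚ k))
    (*≤* (ℤ.+≤+ (ℕ.s≤s (ℕP.+-monoʳ-≤ k ℕ.z≤n))))

  ℕ→ℚ-*-monoʳ-≤ : ∀ n {p q} → p ≤ q → ℕ→ℚ n * p ≤ ℕ→ℚ n * q
  ℕ→ℚ-*-monoʳ-≤ n = *-monoˡ-≤-nonNeg (ℕ→ℚ n) {{nonNegative (ℕ→ℚ-nonNeg n)}}

  *-ℕ→ℚ-monoˡ-≤ : ∀ n {p q} → p ≤ q → p * ℕ→ℚ n ≤ q * ℕ→ℚ n
  *-ℕ→ℚ-monoˡ-≤ n = *-monoʳ-≤-nonNeg (ℕ→ℚ n) {{nonNegative (ℕ→ℚ-nonNeg n)}}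

module Exponential where

  open import Data.Nat as ℕ using (ℕ; zero; suc; _^_; _!)
  import Data.Nat.Properties as ℕP
  open import Data.Nat.Solver using (module +-*-Solver)
  import Data.Rational.Solver
  open import Data.Rational using (ℚ; 0ℚ; 1ℚ; _≤_; _+_; _*_)
  open import Data.Rational.Properties
  open import Data.Product using (_,_)
  open import Relation.Binary.PropositionalEquality
  open import Defs using (ℕ→ℚ; expTerm; expPartial; LeExp)
  open Rationals

  ^-distribʳ-* : ∀ a b k → (a ℕ.* b) ^ k ≡ a ^ k ℕ.* b ^ k
  ^-distribʳ-* a b zero = refl
  ^-distribʳ-* a b (suc k) = begin
    a ℕ.* b ℕ.* (a ℕ.* b) ^ k      ≡⟨ cong (a ℕ.* b ℕ.*_) (^-distribʳ-* a b k) ⟩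
    a ℕ.* b ℕ.* (a ^ k ℕ.* b ^ k)  ≡⟨ solve 4 (λ a b x y → a :* b :* (x :* y) := a :* x :* (b :* y)) refl a b (a ^ k) (b ^ k) ⟩
    a ℕ.* a ^ k ℕ.* (b ℕ.* b ^ k)  ∎
    where
    open ≡-Reasoning
    open +-*-Solver

  [1+z]^[1+k]≤ : ∀ z k → suc z ^ suc k ℕ.≤ z ^ suc k ℕ.+ suc k ℕ.* suc z ^ k
  [1+z]^[1+k]≤ z zero = ℕP.≤-reflexive (solve 1 (λ z → (con 1 :+ z) :* con 1 := z :* con 1 :+ con 1) refl z)
    where open +-*-Solver
  [1+z]^[1+k]≤ z (suc k) = begin
    suc z ℕ.* suc z ^ suc k
      ≤⟨ ℕP.*-monoʳ-≤ (suc z) ([1+z]^[1+k]≤ z k) ⟩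
    suc z ℕ.* (z ^ suc k ℕ.+ suc k ℕ.* suc z ^ k)
      ≡⟨ solve 4 (λ z a k b → (con 1 :+ z) :* (a :+ (con 1 :+ k) :* b)
                            := z :* a :+ a :+ (con 1 :+ k) :* ((con 1 :+ z) :* b)) refl z (z ^ suc k) k (suc z ^ k) ⟩
    z ℕ.* z ^ suc k ℕ.+ z ^ suc k ℕ.+ suc k ℕ.* suc z ^ suc k
      ≤⟨ ℕP.+-monoˡ-≤ (suc k ℕ.* suc z ^ suc k) (ℕP.+-monoʳ-≤ (z ℕ.* z ^ suc k) (ℕP.^-monoˡ-≤ (suc k) (ℕP.n≤1+n z))) ⟩
    z ℕ.* z ^ suc k ℕ.+ suc z ^ suc k ℕ.+ suc k ℕ.* suc z ^ suc k
      ≡⟨ ℕP.+-assoc (z ℕ.* z ^ suc k) _ _ ⟩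
    z ^ suc (suc k) ℕ.+ suc (suc k) ℕ.* suc z ^ suc k ∎
    where
    open ℕP.≤-Reasoning
    open +-*-Solver

  -- z^k/k! ≤ (z+k choose k) ≤ 2^(z+k), proved directly along Pascal's recursion.
  z^k≤2^[z+k]*k! : ∀ z k → z ^ k ℕ.≤ 2 ^ (z ℕ.+ k) ℕ.* k !
  z^k≤2^[z+k]*k! z zero = ℕP.≤-trans (ℕP.m^n>0 2 (z ℕ.+ 0)) (ℕP.≤-reflexive (sym (ℕP.*-identityʳ _)))
  z^k≤2^[z+k]*k! zero (suc k) = ℕ.z≤n
  z^k≤2^[z+k]*k! (suc z) (suc k) = begin
    suc z ^ suc k
      ≤⟨ [1+z]^[1+k]≤ z k ⟩
    z ^ suc k ℕ.+ suc k ℕ.* suc z ^ k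
      ≤⟨ ℕP.+-mono-≤ (z^k≤2^[z+k]*k! z (suc k)) (ℕP.*-monoʳ-≤ (suc k) (z^k≤2^[z+k]*k! (suc z) k)) ⟩
    P ℕ.* suc k ! ℕ.+ suc k ℕ.* (2 ^ suc (z ℕ.+ k) ℕ.* k !)
      ≡⟨ cong (λ e → P ℕ.* suc k ! ℕ.+ suc k ℕ.* (2 ^ e ℕ.* k !)) (sym (ℕP.+-suc z k)) ⟩
    P ℕ.* suc k ! ℕ.+ suc k ℕ.* (P ℕ.* k !)
      ≡⟨ solve 3 (λ p k f → p :* ((con 1 :+ k) :* f) :+ (con 1 :+ k) :* (p :* f)
                          := con 2 :* p :* ((con 1 :+ k) :* f)) refl P k (k !) ⟩
    2 ^ (suc z ℕ.+ suc k) ℕ.* suc k ! ∎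
    where
    open ℕP.≤-Reasoning
    open +-*-Solver
    P : ℕ
    P = 2 ^ (z ℕ.+ suc k)

  y^k*2^k≤16^y*k! : ∀ y k → y ^ k ℕ.* 2 ^ k ℕ.≤ 16 ^ y ℕ.* k !
  y^k*2^k≤16^y*k! y k = ℕP.*-cancelˡ-≤ (2 ^ k) {{ℕ.>-nonZero (ℕP.m^n>0 2 k)}} (begin
    2 ^ k ℕ.* (y ^ k ℕ.* 2 ^ k)        ≡⟨ solve 2 (λ t x → t :* (x :* t) := t :* t :* x) refl (2 ^ k) (y ^ k) ⟩
    2 ^ k ℕ.* 2 ^ k ℕ.* y ^ k          ≡⟨ cong (ℕ._* y ^ k) (sym (^-distribʳ-* 2 2 k)) ⟩
    4 ^ k ℕ.* y ^ k                    ≡⟨ sym (^-distribʳ-* 4 y k) ⟩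
    (4 ℕ.* y) ^ k                      ≤⟨ z^k≤2^[z+k]*k! (4 ℕ.* y) k ⟩
    2 ^ (4 ℕ.* y ℕ.+ k) ℕ.* k !        ≡⟨ cong (ℕ._* k !) (ℕP.^-distribˡ-+-* 2 (4 ℕ.* y) k) ⟩
    2 ^ (4 ℕ.* y) ℕ.* 2 ^ k ℕ.* k !    ≡⟨ cong (λ x → x ℕ.* 2 ^ k ℕ.* k !) (sym (ℕP.^-*-assoc 2 4 y)) ⟩
    16 ^ y ℕ.* 2 ^ k ℕ.* k !           ≡⟨ solve 3 (λ s t f → s :* t :* f := t :* (s :* f)) refl (16 ^ y) (2 ^ k) (k !) ⟩
    2 ^ k ℕ.* (16 ^ y ℕ.* k !)         ∎)
    where
    open ℕP.≤-Reasoning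
    open +-*-Solver

  n!≤n^n : ∀ h → h ! ℕ.≤ h ^ h
  n!≤n^n zero = ℕP.≤-refl
  n!≤n^n (suc h) = ℕP.*-monoʳ-≤ (suc h) (ℕP.≤-trans (n!≤n^n h) (ℕP.^-monoˡ-≤ h (ℕP.n≤1+n h)))

  2^h*h!≤W^h : ∀ h W → 2 ℕ.* h ℕ.≤ W → 2 ^ h ℕ.* h ! ℕ.≤ W ^ h
  2^h*h!≤W^h h W 2h≤W = begin
    2 ^ h ℕ.* h !    ≤⟨ ℕP.*-monoʳ-≤ (2 ^ h) (n!≤n^n h) ⟩
    2 ^ h ℕ.* h ^ h  ≡⟨ sym (^-distribʳ-* 2 h h) ⟩
    (2 ℕ.* h) ^ h    ≤⟨ ℕP.^-monoˡ-≤ h 2h≤W ⟩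
    W ^ h            ∎
    where open ℕP.≤-Reasoning

  expTerm-nonNeg : ∀ {q} → 0ℚ ≤ q → ∀ k → 0ℚ ≤ expTerm q k
  expTerm-nonNeg 0≤q zero = ℕ→ℚ-nonNeg 1
  expTerm-nonNeg 0≤q (suc k) = *-nonNeg (*-nonNeg (expTerm-nonNeg 0≤q k) 0≤q) (1/suc-nonNeg k)

  expTerm-mono : ∀ {q q′} → 0ℚ ≤ q → q ≤ q′ → ∀ k → expTerm q k ≤ expTerm q′ k
  expTerm-mono 0≤q q≤q′ zero = ≤-refl
  expTerm-mono 0≤q q≤q′ (suc k) =
    *-mono-≤-nonNeg (*-nonNeg (expTerm-nonNeg 0≤q k) 0≤q)
      (*-mono-≤-nonNeg (expTerm-nonNeg 0≤q k) (expTerm-mono 0≤q q≤q′ k) 0≤q q≤q′)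
      (1/suc-nonNeg k) ≤-refl

  expPartial-nonNeg : ∀ {q} → 0ℚ ≤ q → ∀ K → 0ℚ ≤ expPartial q K
  expPartial-nonNeg 0≤q zero = ≤-refl
  expPartial-nonNeg 0≤q (suc K) = ≤-trans (expPartial-nonNeg 0≤q K) (≤-+-nonNeg (expTerm-nonNeg 0≤q K))

  expPartial-mono : ∀ {q q′} → 0ℚ ≤ q → q ≤ q′ → ∀ K → expPartial q K ≤ expPartial q′ K
  expPartial-mono 0≤q q≤q′ zero = ≤-refl
  expPartial-mono 0≤q q≤q′ (suc K) = +-mono-≤ (expPartial-mono 0≤q q≤q′ K) (expTerm-mono 0≤q q≤q′ K)

  expTerm-ℕ : ∀ y k → expTerm (ℕ→ℚ y) k * ℕ→ℚ (k !) ≡ ℕ→ℚ (y ^ k)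
  expTerm-ℕ y zero = refl
  expTerm-ℕ y (suc k) = begin
    E * Y * 1/suc k * ℕ→ℚ (suc k ℕ.* k !)
      ≡⟨ cong (E * Y * 1/suc k *_) (ℕ→ℚ-* (suc k) (k !)) ⟩
    E * Y * 1/suc k * (ℕ→ℚ (suc k) * ℕ→ℚ (k !))
      ≡⟨ solve 5 (λ E Y I S F → E :* Y :* I :* (S :* F) := Y :* (E :* F) :* (I :* S)) refl E Y (1/suc k) (ℕ→ℚ (suc k)) (ℕ→ℚ (k !)) ⟩
    Y * (E * ℕ→ℚ (k !)) * (1/suc k * ℕ→ℚ (suc k))
      ≡⟨ cong₂ (λ a b → Y * a * b) (expTerm-ℕ y k) (1/suc-inverse k) ⟩
    Y * ℕ→ℚ (y ^ k) * 1ℚ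
      ≡⟨ *-identityʳ _ ⟩
    Y * ℕ→ℚ (y ^ k)
      ≡⟨ sym (ℕ→ℚ-* y (y ^ k)) ⟩
    ℕ→ℚ (y ^ suc k) ∎
    where
    open ≡-Reasoning
    open Data.Rational.Solver.+-*-Solver
    E Y : ℚ
    E = expTerm (ℕ→ℚ y) k
    Y = ℕ→ℚ y

  expTerm*2^k≤16^y : ∀ y k → expTerm (ℕ→ℚ y) k * ℕ→ℚ (2 ^ k) ≤ ℕ→ℚ (16 ^ y)
  expTerm*2^k≤16^y y k = *-cancelʳ-≤-ℕ (k !) (ℕP.1≤n! k) (begin
    E * T * F                      ≡⟨ solve 3 (λ E T F → E :* T :* F := E :* F :* T) refl E T F ⟩
    E * F * T                      ≡⟨ cong (_* T) (expTerm-ℕ y k) ⟩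
    ℕ→ℚ (y ^ k) * T                ≡⟨ sym (ℕ→ℚ-* (y ^ k) (2 ^ k)) ⟩
    ℕ→ℚ (y ^ k ℕ.* 2 ^ k)          ≤⟨ ℕ→ℚ-mono (y^k*2^k≤16^y*k! y k) ⟩
    ℕ→ℚ (16 ^ y ℕ.* k !)           ≡⟨ ℕ→ℚ-* (16 ^ y) (k !) ⟩
    ℕ→ℚ (16 ^ y) * F               ∎)
    where
    open ≤-Reasoning
    open Data.Rational.Solver.+-*-Solver
    E T F : ℚ
    E = expTerm (ℕ→ℚ y) k
    T = ℕ→ℚ (2 ^ k)
    F = ℕ→ℚ (k !)

  -- The geometric series ∑ B/2^k, with both sides multiplied by 2^K so that no division occurs.
  expPartial-geometric : ∀ y K →
    expPartial (ℕ→ℚ y) K * ℕ→ℚ (2 ^ K) + ℕ→ℚ 2 * ℕ→ℚ (16 ^ y) ≤ ℕ→ℚ 2 * ℕ→ℚ (16 ^ y) * ℕ→ℚ (2 ^ K)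
  expPartial-geometric y zero =
    ≤-reflexive (solve 1 (λ b → con 0ℚ :* con 1ℚ :+ b := b :* con 1ℚ) refl (ℕ→ℚ 2 * ℕ→ℚ (16 ^ y)))
    where open Data.Rational.Solver.+-*-Solver
  expPartial-geometric y (suc K) = begin
    (S + e) * ℕ→ℚ (2 ℕ.* 2 ^ K) + two * B y
      ≡⟨ cong (λ z → (S + e) * z + two * B y) (ℕ→ℚ-* 2 (2 ^ K)) ⟩
    (S + e) * (two * P) + two * B y
      ≡⟨ solve 5 (λ S e t P B → (S :+ e) :* (t :* P) :+ t :* B := t :* (S :* P) :+ t :* (e :* P) :+ t :* B) refl S e two P (B y) ⟩
    two * (S * P) + two * (e * P) + two * B y
      ≤⟨ +-monoˡ-≤ (two * B y) (+-monoʳ-≤ (two * (S * P)) (ℕ→ℚ-*-monoʳ-≤ 2 (expTerm*2^k≤16^y y K))) ⟩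
    two * (S * P) + two * B y + two * B y
      ≡⟨ solve 2 (λ X B → con two :* X :+ con two :* B :+ con two :* B := con two :* (X :+ con two :* B)) refl (S * P) (B y) ⟩
    two * (S * P + two * B y)
      ≤⟨ ℕ→ℚ-*-monoʳ-≤ 2 (expPartial-geometric y K) ⟩
    two * (two * B y * P)
      ≡⟨ solve 3 (λ t B P → t :* (t :* B :* P) := t :* B :* (t :* P)) refl two (B y) P ⟩
    two * B y * (two * P)
      ≡⟨ cong (two * B y *_) (sym (ℕ→ℚ-* 2 (2 ^ K))) ⟩
    two * B y * ℕ→ℚ (2 ℕ.* 2 ^ K) ∎
    where
    open ≤-Reasoning
    open Data.Rational.Solver.+-*-Solver
    S e P two : ℚ
    S = expPartial (ℕ→ℚ y) K
    e = expTerm (ℕ→ℚ y) K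
    P = ℕ→ℚ (2 ^ K)
    two = ℕ→ℚ 2
    B : ℕ → ℚ
    B y = ℕ→ℚ (16 ^ y)

  expPartial≤2*16^y : ∀ y K → expPartial (ℕ→ℚ y) K ≤ ℕ→ℚ (2 ℕ.* 16 ^ y)
  expPartial≤2*16^y y K = *-cancelʳ-≤-ℕ (2 ^ K) (ℕP.m^n>0 2 K) (begin
    expPartial (ℕ→ℚ y) K * ℕ→ℚ (2 ^ K)
      ≤⟨ ≤-+-nonNeg (*-nonNeg (ℕ→ℚ-nonNeg 2) (ℕ→ℚ-nonNeg (16 ^ y))) ⟩
    expPartial (ℕ→ℚ y) K * ℕ→ℚ (2 ^ K) + ℕ→ℚ 2 * ℕ→ℚ (16 ^ y)
      ≤⟨ expPartial-geometric y K ⟩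
    ℕ→ℚ 2 * ℕ→ℚ (16 ^ y) * ℕ→ℚ (2 ^ K)
      ≡⟨ cong (_* ℕ→ℚ (2 ^ K)) (sym (ℕ→ℚ-* 2 (16 ^ y))) ⟩
    ℕ→ℚ (2 ℕ.* 16 ^ y) * ℕ→ℚ (2 ^ K) ∎)
    where open ≤-Reasoning

  LeExp⇒≤ : ∀ a q y → LeExp a q → 0ℚ ≤ q → q ≤ ℕ→ℚ y → a ℕ.≤ 2 ℕ.* 16 ^ y ℕ.+ 1
  LeExp⇒≤ a q y a≤e^q 0≤q q≤y with a≤e^q 1ℚ (1/suc-pos 0)
  ... | K , a≤SK+1 = ℕ→ℚ-mono⁻¹ (≤-trans a≤SK+1
    (subst (expPartial q K + 1ℚ ≤_) (sym (ℕ→ℚ-+ (2 ℕ.* 16 ^ y) 1))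
      (+-monoˡ-≤ 1ℚ (≤-trans (expPartial-mono 0≤q q≤y K) (expPartial≤2*16^y y K)))))

  ≤⇒LeExp : ∀ a h W → a ℕ.≤ 2 ^ h → 2 ℕ.* h ℕ.≤ W → LeExp a (ℕ→ℚ W)
  ≤⇒LeExp a h W a≤2^h 2h≤W ε 0<ε = suc h , ≤-trans (ℕ→ℚ-mono a≤2^h)
    (≤-trans (≤-trans 2^h≤term (subst (_≤ expPartial (ℕ→ℚ W) h + expTerm (ℕ→ℚ W) h) (+-identityˡ _)
                                      (+-monoˡ-≤ _ (expPartial-nonNeg (ℕ→ℚ-nonNeg W) h))))
             (≤-+-nonNeg (<⇒≤ 0<ε)))
    where
    2^h≤term : ℕ→ℚ (2 ^ h) ≤ expTerm (ℕ→ℚ W) h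
    2^h≤term = *-cancelʳ-≤-ℕ (h !) (ℕP.1≤n! h) (begin
      ℕ→ℚ (2 ^ h) * ℕ→ℚ (h !)       ≡⟨ sym (ℕ→ℚ-* (2 ^ h) (h !)) ⟩
      ℕ→ℚ (2 ^ h ℕ.* h !)           ≤⟨ ℕ→ℚ-mono (2^h*h!≤W^h h W 2h≤W) ⟩
      ℕ→ℚ (W ^ h)                   ≡⟨ sym (expTerm-ℕ W h) ⟩
      expTerm (ℕ→ℚ W) h * ℕ→ℚ (h !) ∎)
      where open ≤-Reasoning

module RootedTree {n : ℕ} (tree : Tree n) (r : Fin n) where

  open import Data.Nat hiding (_≟_)
  open import Data.Nat.Properties hiding (_≟_)
  open import Data.Bool using (Bool; true; false; T; not; _∧_; _∨_)
  open import Data.Fin using (toℕ)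
  open import Data.Fin.Properties using (toℕ-injective; toℕ-inject₁; toℕ<n; toℕ-fromℕ)
  open import Data.List using (allFin)
  open import Data.Bool.ListAction using (any)
  open import Data.Product using (Σ; ∃; _×_; _,_; proj₁; proj₂)
  open import Data.Sum using (_⊎_; inj₁; inj₂)
  open import Data.Empty using (⊥; ⊥-elim)
  open import Data.Unit using (tt)
  open import Relation.Nullary using (¬_; yes; no; Dec)
  open import Relation.Binary.PropositionalEquality
  open import Defs hiding (sym; Tree)
  open Counting

  G : Graph n
  G = graph tree

  infix 4 _~_
  _~_ : Fin n → Fin n → Set
  u ~ v = Edge G u v

  ~-sym : ∀ {u v} → u ~ v → v ~ u
  ~-sym {u} {v} = subst T (Graph.sym G u v)

  ~-irrefl : ∀ {v} → ¬ v ~ v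
  ~-irrefl {v} = subst T (Graph.irrefl G v)

  no-closed-path : ∀ m (c : ℕ → Fin n) → 2 ≤ m →
    (∀ i j → i ≤ m → j ≤ m → c i ≡ c j → i ≡ j) →
    (∀ i → i < m → c i ~ c (suc i)) → c m ~ c 0 → ⊥
  no-closed-path zero c ()
  no-closed-path (suc zero) c (s≤s ())
  no-closed-path (suc (suc k)) c _ c-inj c-edges closing = acyclic tree record
    { k = k
    ; c = λ i → c (toℕ i)
    ; inj = λ {i} {j} e → toℕ-injective (c-inj (toℕ i) (toℕ j) (≤-pred (toℕ<n i)) (≤-pred (toℕ<n j)) e)
    ; edges = λ i → subst (λ x → c x ~ c (suc (toℕ i))) (sym (toℕ-inject₁ i)) (c-edges (toℕ i) (toℕ<n i))
    ; close = subst (λ x → c x ~ c 0) (sym (toℕ-fromℕ (suc (suc k)))) closing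
    }

  inBall : ℕ → Fin n → Bool
  inBall zero v = v == r
  inBall (suc k) v = inBall k v ∨ any (λ u → inBall k u ∧ adj G u v) (allFin n)

  inBall-suc : ∀ {k u v} → T (inBall k u) → u ~ v → T (inBall (suc k) v)
  inBall-suc {k} {u} {v} hu e = ∨-introʳ (any-allFin⁺ (λ x → inBall k x ∧ adj G x v) u (∧-intro hu e))

  walk-inBall : ∀ {v} (w : Walk G v r) → Σ ℕ λ k → T (inBall k v)
  walk-inBall (here _) = 0 , ==-refl r
  walk-inBall (step e w) with walk-inBall w
  ... | k , hk = suc k , inBall-suc {k} hk (~-sym e)

  opaque
    depthSpec : ∀ v → Σ ℕ λ k → T (inBall k v) × (∀ j → j < k → ¬ T (inBall j v))
    depthSpec v with walk-inBall (connected tree v r)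
    ... | k , hk with least-≤ (λ j → inBall j v) k hk
    ... | d , _ , hd , minimal = d , hd , minimal

    depth : Fin n → ℕ
    depth v = proj₁ (depthSpec v)

    depth-inBall : ∀ v → T (inBall (depth v) v)
    depth-inBall v = proj₁ (proj₂ (depthSpec v))

    depth-minimal : ∀ {v k} → T (inBall k v) → depth v ≤ k
    depth-minimal {v} hk = ≮⇒≥ (λ k<d → proj₂ (proj₂ (depthSpec v)) _ k<d hk)

  depth-root : depth r ≡ 0
  depth-root = n≤0⇒n≡0 (depth-minimal {r} {0} (==-refl r))

  depth-≡root : ∀ {v} → v ≡ r → depth v ≡ 0
  depth-≡root refl = depth-root

  depth≡0⇒root : ∀ {v} → depth v ≡ 0 → v ≡ r
  depth≡0⇒root {v} e = ==⇒≡ (subst (λ k → T (inBall k v)) e (depth-inBall v))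

  0<depth⇒≢root : ∀ {v} → 0 < depth v → v ≢ r
  0<depth⇒≢root 0<d v≡r = <⇒≢ 0<d (sym (depth-≡root v≡r))

  depth-~ : ∀ {u v} → u ~ v → depth v ≤ suc (depth u)
  depth-~ {u} e = depth-minimal (inBall-suc {depth u} (depth-inBall u) e)

  lower-neighbour-at : ∀ v k → depth v ≡ suc k → ∃ λ u → u ~ v × depth u ≡ k
  lower-neighbour-at v k e with ∨-elim (subst (λ m → T (inBall m v)) e (depth-inBall v))
  ... | inj₁ near = ⊥-elim (1+n≰n (subst (_≤ k) e (depth-minimal near)))
  ... | inj₂ h with any-allFin⁻ (λ x → inBall k x ∧ adj G x v) h
  ... | u , hu with ∧-elim hu
  ... | u∈ball , u~v = u , u~v , ≤-antisym (depth-minimal u∈ball)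
                                          (≤-pred (subst (_≤ suc (depth u)) e (depth-~ u~v)))

  lower-neighbour : ∀ {v} → v ≢ r → ∃ λ u → u ~ v × suc (depth u) ≡ depth v
  lower-neighbour {v} v≢r with depth v in eq
  ... | zero = ⊥-elim (v≢r (depth≡0⇒root eq))
  ... | suc k with lower-neighbour-at v k eq
  ... | u , u~v , du = u , u~v , cong suc du

  isParent : Fin n → Fin n → Bool
  isParent v u = adj G u v ∧ (suc (depth u) ≡ᵇ depth v)

  parent : Fin n → Fin n
  parent v = find (isParent v) r

  parent-spec : ∀ v → v ≢ r → parent v ~ v × suc (depth (parent v)) ≡ depth v
  parent-spec v v≢r with lower-neighbour v≢r
  ... | u , u~v , du with ∧-elim (find-sound (isParent v) r u (∧-intro u~v (≡⇒≡ᵇ _ _ du)))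
  ... | p~v , dp = p~v , ≡ᵇ⇒≡ _ _ dp

  parent-~ : ∀ v → v ≢ r → parent v ~ v
  parent-~ v v≢r = proj₁ (parent-spec v v≢r)

  depth-nonroot : ∀ {v} → v ≢ r → depth v ≡ suc (depth (parent v))
  depth-nonroot {v} v≢r = sym (proj₂ (parent-spec v v≢r))

  parent-root : parent r ≡ r
  parent-root = find-default (isParent r) r
    (λ u h → 0≢1+n (sym (trans (≡ᵇ⇒≡ _ _ (proj₂ (∧-elim h))) depth-root)))

  depth-parent : ∀ v → depth (parent v) ≡ depth v ∸ 1
  depth-parent v with v Data.Fin.≟ r
  ... | yes refl = trans (cong depth parent-root) (trans depth-root (sym (cong (_∸ 1) depth-root)))
  ... | no v≢r = sym (cong (_∸ 1) (depth-nonroot v≢r))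

  ancestor : ℕ → Fin n → Fin n
  ancestor zero v = v
  ancestor (suc k) v = parent (ancestor k v)

  depth-ancestor : ∀ k v → depth (ancestor k v) ≡ depth v ∸ k
  depth-ancestor zero v = refl
  depth-ancestor (suc k) v = begin
    depth (parent (ancestor k v)) ≡⟨ depth-parent (ancestor k v) ⟩
    depth (ancestor k v) ∸ 1      ≡⟨ cong (_∸ 1) (depth-ancestor k v) ⟩
    depth v ∸ k ∸ 1               ≡⟨ ∸-+-assoc (depth v) k 1 ⟩
    depth v ∸ (k + 1)             ≡⟨ cong (depth v ∸_) (+-comm k 1) ⟩
    depth v ∸ suc k               ∎
    where open ≡-Reasoning

  ancestor-+ : ∀ a b v → ancestor (a + b) v ≡ ancestor a (ancestor b v)
  ancestor-+ zero b v = refl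
  ancestor-+ (suc a) b v = cong parent (ancestor-+ a b v)

  ancestor-depth : ∀ v → ancestor (depth v) v ≡ r
  ancestor-depth v = depth≡0⇒root (trans (depth-ancestor (depth v) v) (n∸n≡0 (depth v)))

  ancestor-≢root : ∀ k v → k < depth v → ancestor k v ≢ r
  ancestor-≢root k v k<d e = <⇒≱ k<d (m∸n≡0⇒m≤n (trans (sym (depth-ancestor k v)) (depth-≡root e)))

  ancestor-injective : ∀ v a b → a ≤ depth v → b ≤ depth v → ancestor a v ≡ ancestor b v → a ≡ b
  ancestor-injective v a b a≤d b≤d e =
    ∸-cancelˡ-≡ a≤d b≤d (trans (sym (depth-ancestor a v)) (trans (cong depth e) (depth-ancestor b v)))

  ancestor-~ : ∀ k v → suc k ≤ depth v → ancestor (suc k) v ~ ancestor k v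
  ancestor-~ k v k<d = parent-~ (ancestor k v) (ancestor-≢root k v k<d)

  private
    mirror-< : ∀ j k → j < k → k ≤ j + j → j + j ∸ k < j
    mirror-< j k j<k k≤2j = +-cancelʳ-≤ k (suc (j + j ∸ k)) j (begin
      suc (j + j ∸ k) + k  ≡⟨ cong suc (m∸n+n≡m k≤2j) ⟩
      suc (j + j)          ≡⟨ +-suc j j ⟨
      j + suc j            ≤⟨ +-monoʳ-≤ j j<k ⟩
      j + k                ∎)
      where open ≤-Reasoning

  -- Two distinct vertices of equal depth are not adjacent and have no common neighbour one level
  -- deeper: either would close a cycle through the point where their ancestor chains meet.
  module Meet (x y : Fin n) (x≢y : x ≢ y) (same-depth : depth x ≡ depth y) where

    d : ℕ
    d = depth x

    meets : ℕ → Bool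
    meets i = ancestor i x == ancestor i y

    meet-spec : Σ ℕ λ k → k ≤ d × T (meets k) × (∀ i → i < k → ¬ T (meets i))
    meet-spec = least-≤ meets d (≡⇒== (trans (ancestor-depth x)
                  (sym (trans (cong (λ k → ancestor k y) same-depth) (ancestor-depth y)))))

    j : ℕ
    j = proj₁ meet-spec

    j≤d : j ≤ d
    j≤d = proj₁ (proj₂ meet-spec)

    j≤depth-y : j ≤ depth y
    j≤depth-y = subst (j ≤_) same-depth j≤d

    j-meets : ancestor j x ≡ ancestor j y
    j-meets = ==⇒≡ (proj₁ (proj₂ (proj₂ meet-spec)))

    j-minimal : ∀ i → i < j → ancestor i x ≢ ancestor i y
    j-minimal i i<j e = proj₂ (proj₂ (proj₂ meet-spec)) i i<j (≡⇒== e)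

    1≤j : 1 ≤ j
    1≤j with j in eq
    ... | zero = ⊥-elim (x≢y (subst (λ k → ancestor k x ≡ ancestor k y) eq j-meets))
    ... | suc _ = s≤s z≤n

    -- The walk x = c 0, …, c j (the meeting point), …, c (2j) = y, then z.
    path : Fin n → ℕ → Fin n
    path z i with i ≤? j
    ... | yes _ = ancestor i x
    ... | no _ with i ≤? j + j
    ... | yes _ = ancestor (j + j ∸ i) y
    ... | no _ = z

    module _ (z : Fin n) where

      c : ℕ → Fin n
      c = path z

      c-up : ∀ i → i ≤ j → c i ≡ ancestor i x
      c-up i i≤j with i ≤? j
      ... | yes _ = refl
      ... | no i≰j = ⊥-elim (i≰j i≤j)

      c-down : ∀ i → j ≤ i → i ≤ j + j → c i ≡ ancestor (j + j ∸ i) y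
      c-down i j≤i i≤2j with i ≤? j
      ... | yes i≤j = trans (cong (λ k → ancestor k x) i≡j)
                       (trans j-meets (cong (λ k → ancestor k y) (trans (sym (m+n∸n≡m j j)) (cong (j + j ∸_) (sym i≡j)))))
        where
        i≡j : i ≡ j
        i≡j = ≤-antisym i≤j j≤i
      ... | no _ with i ≤? j + j
      ... | yes _ = refl
      ... | no i≰2j = ⊥-elim (i≰2j i≤2j)

      c-end : c (suc (j + j)) ≡ z
      c-end with suc (j + j) ≤? j
      ... | yes 2j<j = ⊥-elim (<⇒≱ (s≤s (m≤m+n j j)) 2j<j)
      ... | no _ with suc (j + j) ≤? j + j
      ... | yes 2j<2j = ⊥-elim (1+n≰n 2j<2j)
      ... | no _ = refl

      c-y : c (j + j) ≡ y
      c-y = trans (c-down (j + j) (m≤m+n j j) ≤-refl) (cong (λ k → ancestor k y) (n∸n≡0 (j + j)))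

      c-edge : ∀ i → i < j + j → c i ~ c (suc i)
      c-edge i i<2j = by-cases (suc i ≤? j)
        where
        by-cases : Dec (suc i ≤ j) → c i ~ c (suc i)
        by-cases (yes i<j) = subst₂ _~_ (sym (c-up i (<⇒≤ i<j))) (sym (c-up (suc i) i<j))
                               (~-sym (ancestor-~ i x (≤-trans i<j j≤d)))
        by-cases (no i≮j) = subst₂ _~_
            (sym (trans (c-down i j≤i (<⇒≤ i<2j)) (cong (λ k → ancestor k y) (+-∸-assoc 1 i<2j))))
            (sym (c-down (suc i) (≤-trans j≤i (n≤1+n i)) i<2j))
            (ancestor-~ (j + j ∸ suc i) y (≤-trans (mirror-< j (suc i) (s≤s j≤i) i<2j) j≤depth-y))
          where
          j≤i : j ≤ i
          j≤i = ≤-pred (≰⇒> i≮j)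

      c-depth : ∀ i → i ≤ j + j → depth (c i) ≤ d
      c-depth i i≤2j = by-cases (i ≤? j)
        where
        by-cases : Dec (i ≤ j) → depth (c i) ≤ d
        by-cases (yes i≤j) = subst (_≤ d) (sym (trans (cong depth (c-up i i≤j)) (depth-ancestor i x))) (m∸n≤m d i)
        by-cases (no i≰j) = subst (_≤ d)
            (sym (trans (cong depth (c-down i (<⇒≤ (≰⇒> i≰j)) i≤2j))
                   (trans (depth-ancestor (j + j ∸ i) y) (cong (_∸ (j + j ∸ i)) (sym same-depth)))))
            (m∸n≤m d (j + j ∸ i))

      up≢down : ∀ i m → i ≤ j → m < j → ancestor i x ≢ ancestor m y
      up≢down i m i≤j m<j e = j-minimal i (subst (_< j) (sym i≡m) m<j)
                                (trans e (cong (λ k → ancestor k y) (sym i≡m)))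
        where
        i≡m : i ≡ m
        i≡m = ∸-cancelˡ-≡ (≤-trans i≤j j≤d) (≤-trans (<⇒≤ m<j) j≤d)
                (trans (sym (depth-ancestor i x))
                  (trans (cong depth e) (trans (depth-ancestor m y) (cong (_∸ m) (sym same-depth)))))

      c-injective : ∀ i i′ → i ≤ j + j → i′ ≤ j + j → c i ≡ c i′ → i ≡ i′
      c-injective i i′ i≤ i′≤ e = by-cases (i ≤? j) (i′ ≤? j)
        where
        by-cases : Dec (i ≤ j) → Dec (i′ ≤ j) → i ≡ i′
        by-cases (yes a) (yes b) = ancestor-injective x i i′ (≤-trans a j≤d) (≤-trans b j≤d)
                                     (trans (sym (c-up i a)) (trans e (c-up i′ b)))
        by-cases (yes a) (no b) = ⊥-elim (up≢down i _ a (mirror-< j i′ (≰⇒> b) i′≤)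
                                    (trans (sym (c-up i a)) (trans e (c-down i′ (<⇒≤ (≰⇒> b)) i′≤))))
        by-cases (no a) (yes b) = ⊥-elim (up≢down i′ _ b (mirror-< j i (≰⇒> a) i≤)
                                    (trans (sym (c-up i′ b)) (trans (sym e) (c-down i (<⇒≤ (≰⇒> a)) i≤))))
        by-cases (no a) (no b) = ∸-cancelˡ-≡ i≤ i′≤ (ancestor-injective y _ _
                                   (≤-trans (<⇒≤ (mirror-< j i (≰⇒> a) i≤)) j≤depth-y)
                                   (≤-trans (<⇒≤ (mirror-< j i′ (≰⇒> b) i′≤)) j≤depth-y)
                                   (trans (sym (c-down i (<⇒≤ (≰⇒> a)) i≤)) (trans e (c-down i′ (<⇒≤ (≰⇒> b)) i′≤))))

    2≤2j : 2 ≤ j + j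
    2≤2j = +-mono-≤ 1≤j 1≤j

    not-adjacent : ¬ y ~ x
    not-adjacent y~x = no-closed-path (j + j) (c x) 2≤2j (c-injective x) (c-edge x)
      (subst₂ _~_ (sym (c-y x)) (sym (c-up x 0 z≤n)) y~x)

    no-common-lower-neighbour : ∀ z → y ~ z → z ~ x → depth z ≡ suc d → ⊥
    no-common-lower-neighbour z y~z z~x dz = no-closed-path (suc (j + j)) (c z) (≤-trans 2≤2j (n≤1+n _))
      injective edges (subst₂ _~_ (sym (c-end z)) (sym (c-up z 0 z≤n)) z~x)
      where
      c≢z : ∀ i → i ≤ j + j → c z i ≢ z
      c≢z i i≤ e = 1+n≰n (subst (_≤ d) (trans (cong depth e) dz) (c-depth z i i≤))
      injective : ∀ i i′ → i ≤ suc (j + j) → i′ ≤ suc (j + j) → c z i ≡ c z i′ → i ≡ i′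
      injective i i′ i≤ i′≤ e with m≤n⇒m<n∨m≡n i≤ | m≤n⇒m<n∨m≡n i′≤
      ... | inj₁ a | inj₁ b = c-injective z i i′ (≤-pred a) (≤-pred b) e
      ... | inj₁ a | inj₂ refl = ⊥-elim (c≢z i (≤-pred a) (trans e (c-end z)))
      ... | inj₂ refl | inj₁ b = ⊥-elim (c≢z i′ (≤-pred b) (trans (sym e) (c-end z)))
      ... | inj₂ refl | inj₂ refl = refl
      edges : ∀ i → i < suc (j + j) → c z i ~ c z (suc i)
      edges i i< with m≤n⇒m<n∨m≡n (≤-pred i<)
      ... | inj₁ i<2j = c-edge z i i<2j
      ... | inj₂ refl = subst₂ _~_ (sym (c-y z)) (sym (c-end z)) y~z

  ~⇒depth-≢ : ∀ {u v} → u ~ v → depth u ≢ depth v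
  ~⇒depth-≢ {u} {v} u~v du≡dv = Meet.not-adjacent v u v≢u (sym du≡dv) u~v
    where
    v≢u : v ≢ u
    v≢u refl = ~-irrefl u~v

  ~-deeper⇒parent : ∀ {u v} → u ~ v → depth v ≡ suc (depth u) → parent v ≡ u
  ~-deeper⇒parent {u} {v} u~v dv with parent v Data.Fin.≟ u
  ... | yes p≡u = p≡u
  ... | no p≢u = ⊥-elim (Meet.no-common-lower-neighbour (parent v) u p≢u same-depth v u~v
                          (~-sym (parent-~ v v≢r)) (depth-nonroot v≢r))
    where
    v≢r : v ≢ r
    v≢r = 0<depth⇒≢root (subst (0 <_) (sym dv) (s≤s z≤n))
    same-depth : depth (parent v) ≡ depth u
    same-depth = trans (depth-parent v) (cong (_∸ 1) dv)

  ~⇒parent⊎child : ∀ {u v} → u ~ v → (v ≢ r × u ≡ parent v) ⊎ (u ≢ r × parent u ≡ v)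
  ~⇒parent⊎child {u} {v} u~v
    with m≤n⇒m<n∨m≡n (depth-~ u~v) | m≤n⇒m<n∨m≡n (depth-~ (~-sym u~v))
  ... | inj₂ dv | _ = inj₁ (0<depth⇒≢root (subst (0 <_) (sym dv) (s≤s z≤n)) , sym (~-deeper⇒parent u~v dv))
  ... | inj₁ _ | inj₂ du = inj₂ (0<depth⇒≢root (subst (0 <_) (sym du) (s≤s z≤n)) , ~-deeper⇒parent (~-sym u~v) du)
  ... | inj₁ dv< | inj₁ du< = ⊥-elim (~⇒depth-≢ u~v (≤-antisym (≤-pred du<) (≤-pred dv<)))

  isChild : Fin n → Fin n → Bool
  isChild v u = not (u == r) ∧ (parent u == v)

  children : Fin n → ℕ
  children v = count (isChild v)

  isChild⁻ : ∀ {v u} → T (isChild v u) → u ≢ r × parent u ≡ v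
  isChild⁻ h = (λ u≡r → not-elim (proj₁ (∧-elim h)) (≡⇒== u≡r)) , ==⇒≡ (proj₂ (∧-elim h))

  isChild⁺ : ∀ {v u} → u ≢ r → parent u ≡ v → T (isChild v u)
  isChild⁺ u≢r pu≡v = ∧-intro (not-intro (λ h → u≢r (==⇒≡ h))) (≡⇒== pu≡v)

  isChild-depth : ∀ {v u} → T (isChild v u) → depth u ≡ suc (depth v)
  isChild-depth h with isChild⁻ h
  ... | u≢r , refl = depth-nonroot u≢r

  isChild-~ : ∀ {v u} → T (isChild v u) → v ~ u
  isChild-~ h with isChild⁻ h
  ... | u≢r , refl = parent-~ _ u≢r

  isChild-count : ∀ {v u} → T (isChild v u) → 1 ≤ children v
  isChild-count {v} {u} h = count-point (isChild v) u h

  private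
    n≢2+n : ∀ m → m ≢ suc (suc m)
    n≢2+n m e = <-irrefl e (s≤s (n≤1+n m))

    adj-child-or-parent : ∀ v u →
      χ (adj G v u) ≡ χ (isChild v u) + χ (not (v == r) ∧ (u == parent v))
    adj-child-or-parent v u with adj G v u in eq
    ... | true = by-cases (~⇒parent⊎child (~-sym {v} {u} (T-≡true eq)))
      where
      by-cases : (v ≢ r × u ≡ parent v) ⊎ (u ≢ r × parent u ≡ v) →
                 1 ≡ χ (isChild v u) + χ (not (v == r) ∧ (u == parent v))
      by-cases (inj₁ (v≢r , u≡pv)) = sym (cong₂ _+_ (χ-false not-child)
                                        (χ-true (∧-intro (not-intro (λ h → v≢r (==⇒≡ h))) (≡⇒== u≡pv))))
        where
        not-child : ¬ T (isChild v u)
        not-child h = n≢2+n (depth u) (trans (isChild-depth h)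
                        (cong suc (trans (depth-nonroot v≢r) (cong (λ w → suc (depth w)) (sym u≡pv)))))
      by-cases (inj₂ (u≢r , pu≡v)) = sym (cong₂ _+_ (χ-true (isChild⁺ u≢r pu≡v))
                                        (χ-false (λ h → not-parent (==⇒≡ (proj₂ (∧-elim h))))))
        where
        not-parent : u ≢ parent v
        not-parent u≡pv = <⇒≱ (n<1+n (depth v)) (subst (_≤ depth v)
          (trans (sym (depth-parent v)) (trans (cong depth (sym u≡pv))
            (trans (depth-nonroot u≢r) (cong (λ w → suc (depth w)) pu≡v))))
          (m∸n≤m (depth v) 1))
    ... | false = sym (cong₂ _+_ (χ-false (λ h → subst T eq (isChild-~ h)))
                                  (χ-false (λ h → subst T eq (~-sym (parent-edge h)))))
      where
      parent-edge : T (not (v == r) ∧ (u == parent v)) → u ~ v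
      parent-edge h with ∧-elim h
      ... | v≢r , u≡pv = subst (_~ v) (sym (==⇒≡ u≡pv)) (parent-~ v (λ e → not-elim v≢r (≡⇒== e)))

  degree-children : ∀ v → degree G v ≡ children v + χ (not (v == r))
  degree-children v = begin
    degree G v
      ≡⟨ countB-allFin (adj G v) ⟩
    ∑ (λ u → χ (adj G v u))
      ≡⟨ ∑-cong (adj-child-or-parent v) ⟩
    ∑ (λ u → χ (isChild v u) + χ (not (v == r) ∧ (u == parent v)))
      ≡⟨ ∑-+ (λ u → χ (isChild v u)) (λ u → χ (not (v == r) ∧ (u == parent v))) ⟩
    children v + count (λ u → not (v == r) ∧ (u == parent v))
      ≡⟨ cong (children v +_) parent-count ⟩
    children v + χ (not (v == r)) ∎
    where
    open ≡-Reasoning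
    parent-count : count (λ u → not (v == r) ∧ (u == parent v)) ≡ χ (not (v == r))
    parent-count with v == r
    ... | true = count-none {n} {λ _ → false} (λ _ ())
    ... | false = count-== (parent v)

  Δ : ℕ
  Δ = maxDegree G

  degree≤Δ : ∀ v → degree G v ≤ Δ
  degree≤Δ = ≤-foldr-⊔-allFin (degree G)

  children≤Δ : ∀ v → children v ≤ Δ
  children≤Δ v = ≤-trans (m≤m+n (children v) _) (≤-trans (≤-reflexive (sym (degree-children v))) (degree≤Δ v))

  degree-nonroot : ∀ {v} → v ≢ r → degree G v ≡ suc (children v)
  degree-nonroot {v} v≢r = trans (degree-children v)
    (trans (cong (λ b → children v + χ (not b)) v≠r) (+-comm (children v) 1))
    where
    v≠r : (v == r) ≡ false
    v≠r with v == r in e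
    ... | true = ⊥-elim (v≢r (==⇒≡ (T-≡true e)))
    ... | false = refl

  leaf⇒childless : ∀ {v} → v ≢ r → T (isLeaf G v) → children v ≡ 0
  leaf⇒childless {v} v≢r h = suc-injective (trans (sym (degree-nonroot v≢r)) (≡ᵇ⇒≡ (degree G v) 1 h))

  childless⇒leaf : ∀ {v} → v ≢ r → children v ≡ 0 → T (isLeaf G v)
  childless⇒leaf {v} v≢r h = ≡⇒≡ᵇ (degree G v) 1 (trans (degree-nonroot v≢r) (cong suc h))

  only-child : ∀ {v a b} → children v ≡ 1 → T (isChild v a) → T (isChild v b) → a ≡ b
  only-child {v} {a} {b} one ha hb with a Data.Fin.≟ b
  ... | yes a≡b = a≡b
  ... | no a≢b = ⊥-elim (1+n≰n (subst (2 ≤_) one (2≤count (isChild v) a b ha hb a≢b)))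

  ancestor-injective-on-chains : ∀ a v w → a ≤ depth v → a ≤ depth w →
    (∀ m → 1 ≤ m → m ≤ a → children (ancestor m v) ≡ 1) → ancestor a v ≡ ancestor a w → v ≡ w
  ancestor-injective-on-chains zero v w _ _ _ e = e
  ancestor-injective-on-chains (suc a) v w a<dv a<dw chain e =
    ancestor-injective-on-chains a v w (≤-trans (n≤1+n a) a<dv) (≤-trans (n≤1+n a) a<dw)
      (λ m 1≤m m≤a → chain m 1≤m (≤-trans m≤a (n≤1+n a)))
      (only-child (chain (suc a) (s≤s z≤n) ≤-refl)
        (isChild⁺ (ancestor-≢root a v a<dv) refl)
        (isChild⁺ (ancestor-≢root a w a<dw) (sym e)))

  ancestorAt : ℕ → Fin n → Fin n
  ancestorAt d v = ancestor (depth v ∸ d) v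

  depth-ancestorAt : ∀ {d v} → d ≤ depth v → depth (ancestorAt d v) ≡ d
  depth-ancestorAt {d} {v} d≤dv = trans (depth-ancestor (depth v ∸ d) v) (m∸[m∸n]≡n d≤dv)

  ancestorAt-depth : ∀ v → ancestorAt (depth v) v ≡ v
  ancestorAt-depth v = cong (λ k → ancestor k v) (n∸n≡0 (depth v))

  ancestorAt-ancestor : ∀ {c k v} → c + k ≤ depth v → ancestorAt c (ancestor k v) ≡ ancestorAt c v
  ancestorAt-ancestor {c} {k} {v} c+k≤dv = begin
    ancestor (depth (ancestor k v) ∸ c) (ancestor k v)  ≡⟨ ancestor-+ (depth (ancestor k v) ∸ c) k v ⟨
    ancestor (depth (ancestor k v) ∸ c + k) v           ≡⟨ cong (λ m → ancestor m v) offset ⟩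
    ancestor (depth v ∸ c) v                            ∎
    where
    open ≡-Reasoning
    k≤dv∸c : k ≤ depth v ∸ c
    k≤dv∸c = subst (_≤ depth v ∸ c) (m+n∸m≡n c k) (∸-monoˡ-≤ c c+k≤dv)
    offset : depth (ancestor k v) ∸ c + k ≡ depth v ∸ c
    offset = begin
      depth (ancestor k v) ∸ c + k  ≡⟨ cong (λ m → m ∸ c + k) (depth-ancestor k v) ⟩
      depth v ∸ k ∸ c + k           ≡⟨ cong (_+ k) (∸-+-assoc (depth v) k c) ⟩
      depth v ∸ (k + c) + k         ≡⟨ cong (λ m → depth v ∸ m + k) (+-comm k c) ⟩
      depth v ∸ (c + k) + k         ≡⟨ cong (_+ k) (∸-+-assoc (depth v) c k) ⟨
      depth v ∸ c ∸ k + k           ≡⟨ m∸n+n≡m k≤dv∸c ⟩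
      depth v ∸ c                   ∎

  ancestorAt-parent : ∀ {d v} → d < depth v → ancestorAt d v ≡ ancestorAt d (parent v)
  ancestorAt-parent {d} {v} d<dv = sym (ancestorAt-ancestor {d} {1} {v} (subst (_≤ depth v) (+-comm 1 d) d<dv))

  ancestorAt-suc : ∀ {d v} → d < depth v → ancestorAt d v ≡ parent (ancestorAt (suc d) v)
  ancestorAt-suc {d} {v} d<dv = cong (λ k → ancestor k v) (+-∸-assoc 1 d<dv)

  allBelow : ℕ → (ℕ → Bool) → Bool
  allBelow zero p = true
  allBelow (suc k) p = p k ∧ allBelow k p

  allBelow⁻ : ∀ k p → T (allBelow k p) → ∀ i → i < k → T (p i)
  allBelow⁻ (suc k) p h i i<k with m≤n⇒m<n∨m≡n (≤-pred i<k)
  ... | inj₁ i<k′ = allBelow⁻ k p (proj₂ (∧-elim h)) i i<k′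
  ... | inj₂ refl = proj₁ (∧-elim h)

  allBelow⁺ : ∀ k p → (∀ i → i < k → T (p i)) → T (allBelow k p)
  allBelow⁺ zero p h = tt
  allBelow⁺ (suc k) p h = ∧-intro (h k ≤-refl) (allBelow⁺ k p (λ i i<k → h i (≤-trans i<k (n≤1+n k))))

  nonUnary : Fin n → Bool
  nonUnary u = (u == r) ∨ not (children u ≡ᵇ 1)

  unary : ∀ {u} → ¬ T (nonUnary u) → u ≢ r × children u ≡ 1
  unary {u} h = (λ u≡r → h (∨-introˡ (≡⇒== u≡r))) , one
    where
    one : children u ≡ 1
    one with children u ≡ᵇ 1 in e
    ... | true = ≡ᵇ⇒≡ (children u) 1 (T-≡true e)
    ... | false = ⊥-elim (h (∨-introʳ {u == r} tt))

  unaryChain : ℕ → Fin n → Bool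
  unaryChain m v = allBelow m (λ i → not (nonUnary (ancestor (suc i) v)))

  unaryChain-unary : ∀ {m v} → T (unaryChain m v) → ∀ k → 1 ≤ k → k ≤ m →
    ancestor k v ≢ r × children (ancestor k v) ≡ 1
  unaryChain-unary {m} h (suc k) _ k<m = unary (not-elim (allBelow⁻ m _ h k k<m))

  unaryChain-children : ∀ {m v} → T (unaryChain m v) → ∀ k → 1 ≤ k → k ≤ m → children (ancestor k v) ≡ 1
  unaryChain-children h k 1≤k k≤m = proj₂ (unaryChain-unary h k 1≤k k≤m)

module BarePaths {n : ℕ} (tree : Tree n) (r : Fin n) (ℓ : ℕ) where

  open import Data.Nat hiding (_≟_)
  open import Data.Nat.Properties hiding (_≟_)
  open import Data.Nat.DivMod using (_%_; _mod_; m≡m%n+[m/n]*n; m%n<n; /-monoˡ-≤)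
  open import Data.Bool using (Bool; T; _∧_)
  open import Data.Fin using (toℕ)
  open import Data.Fin.Properties using (toℕ-injective; toℕ-inject₁; toℕ<n; toℕ-fromℕ<)
  open import Data.Product using (Σ; _×_; _,_; proj₁; proj₂)
  open import Data.Sum using (inj₁; inj₂)
  open import Data.Empty using (⊥-elim)
  open import Relation.Nullary using (¬_)
  open import Relation.Binary.PropositionalEquality
  open import Relation.Binary.Definitions using (tri<; tri≈; tri>)
  open import Defs hiding (sym; Tree)
  open Counting
  open RootedTree tree r

  startsBarePath : Fin n → Bool
  startsBarePath v = (ℓ <ᵇ depth v) ∧ unaryChain ℓ v

  ℓ<depth : ∀ {v} → T (startsBarePath v) → ℓ < depth v
  ℓ<depth {v} h = <ᵇ⇒< ℓ (depth v) (proj₁ (∧-elim h))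

  startsBarePath-chain : ∀ {v} → T (startsBarePath v) → T (unaryChain ℓ v)
  startsBarePath-chain {v} h = proj₂ (∧-elim {ℓ <ᵇ depth v} h)

  upwardPath : Fin n → Fin (suc ℓ) → Fin n
  upwardPath v i = ancestor (toℕ i) v

  upwardPath-bare : ∀ {v} → T (startsBarePath v) → BarePath G ℓ (upwardPath v)
  upwardPath-bare {v} h = record
    { inj = λ {i} {j} e → toℕ-injective (ancestor-injective v (toℕ i) (toℕ j) (bound i) (bound j) e)
    ; edges = λ i → subst (λ k → ancestor k v ~ ancestor (suc (toℕ i)) v) (sym (toℕ-inject₁ i))
                      (~-sym (ancestor-~ (toℕ i) v (≤-trans (toℕ<n i) (<⇒≤ (ℓ<depth h)))))
    ; inner = λ i 0<i i<ℓ → trans (degree-nonroot (ancestor-≢root (toℕ i) v (<-trans i<ℓ (ℓ<depth h))))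
                              (cong suc (unaryChain-children (startsBarePath-chain h) (toℕ i) 0<i (<⇒≤ i<ℓ)))
    }
    where
    bound : ∀ (i : Fin (suc ℓ)) → toℕ i ≤ depth v
    bound i = ≤-trans (≤-pred (toℕ<n i)) (<⇒≤ (ℓ<depth h))

  startsBarePathAt : Fin (suc ℓ) → Fin n → Bool
  startsBarePathAt ρ v = startsBarePath v ∧ (depth v mod suc ℓ == ρ)

  private
    %-shift≡⇒0 : ∀ m x e → x % suc m ≡ (x + e) % suc m → e ≤ m → e ≡ 0
    %-shift≡⇒0 m x e same e≤m with <-cmp (x / suc m) ((x + e) / suc m)
    ... | tri≈ _ q≡ _ = +-cancelˡ-≡ (x % suc m + x / suc m * suc m) e 0 (begin
        x % suc m + x / suc m * suc m + e              ≡⟨ cong (_+ e) (sym (m≡m%n+[m/n]*n x (suc m))) ⟩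
        x + e                                          ≡⟨ m≡m%n+[m/n]*n (x + e) (suc m) ⟩
        (x + e) % suc m + (x + e) / suc m * suc m      ≡⟨ cong₂ (λ a b → a + b * suc m) (sym same) (sym q≡) ⟩
        x % suc m + x / suc m * suc m                  ≡⟨ +-identityʳ _ ⟨
        x % suc m + x / suc m * suc m + 0              ∎)
      where open ≡-Reasoning
    ... | tri< q< _ _ = ⊥-elim (<⇒≱ (s≤s e≤m) (+-cancelˡ-≤ (x % suc m + x / suc m * suc m) (suc m) e (begin
        x % suc m + x / suc m * suc m + suc m          ≡⟨ +-assoc (x % suc m) _ _ ⟩
        x % suc m + (x / suc m * suc m + suc m)        ≡⟨ cong (x % suc m +_) (+-comm _ (suc m)) ⟩
        x % suc m + suc (x / suc m) * suc m            ≤⟨ +-monoʳ-≤ (x % suc m) (*-monoˡ-≤ (suc m) q<) ⟩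
        x % suc m + (x + e) / suc m * suc m            ≡⟨ cong (_+ (x + e) / suc m * suc m) same ⟩
        (x + e) % suc m + (x + e) / suc m * suc m      ≡⟨ m≡m%n+[m/n]*n (x + e) (suc m) ⟨
        x + e                                          ≡⟨ cong (_+ e) (m≡m%n+[m/n]*n x (suc m)) ⟩
        x % suc m + x / suc m * suc m + e              ∎)))
      where open ≤-Reasoning
    ... | tri> _ _ q> = ⊥-elim (<⇒≱ q> (/-monoˡ-≤ (suc m) (m≤m+n x e)))

    -- Windows [d - ℓ, d] ending at depths d ≡ d′ mod (ℓ+1) meet only at equal offsets.
    same-offset : ∀ d d′ a b → a ≤ b → b ≤ ℓ → a ≤ d → b ≤ d′ → d ∸ a ≡ d′ ∸ b →
      d % suc ℓ ≡ d′ % suc ℓ → a ≡ b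
    same-offset d d′ a b a≤b b≤ℓ a≤d b≤d′ meet same-residue =
      trans (sym (+-identityʳ a)) (trans (cong (a +_) (sym gap≡0)) (m+[n∸m]≡n a≤b))
      where
      d′≡d+gap : d′ ≡ d + (b ∸ a)
      d′≡d+gap = begin
        d′                          ≡⟨ m∸n+n≡m b≤d′ ⟨
        d′ ∸ b + b                  ≡⟨ cong (_+ b) (sym meet) ⟩
        d ∸ a + b                   ≡⟨ cong (d ∸ a +_) (m+[n∸m]≡n a≤b) ⟨
        d ∸ a + (a + (b ∸ a))       ≡⟨ +-assoc (d ∸ a) a (b ∸ a) ⟨
        d ∸ a + a + (b ∸ a)         ≡⟨ cong (_+ (b ∸ a)) (m∸n+n≡m a≤d) ⟩
        d + (b ∸ a)                 ∎
        where open ≡-Reasoning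
      gap≡0 : b ∸ a ≡ 0
      gap≡0 = %-shift≡⇒0 ℓ d (b ∸ a) (trans same-residue (cong (_% suc ℓ) d′≡d+gap)) (≤-trans (m∸n≤m b a) b≤ℓ)

  startsBarePathAt-residue : ∀ {ρ v} → T (startsBarePathAt ρ v) → depth v % suc ℓ ≡ toℕ ρ
  startsBarePathAt-residue {ρ} {v} h =
    trans (sym (toℕ-fromℕ< (m%n<n (depth v) (suc ℓ)))) (cong toℕ (==⇒≡ (proj₂ (∧-elim {startsBarePath v} h))))

  startsBarePathAt-disjoint : ∀ {ρ v w} a b → T (startsBarePathAt ρ v) → T (startsBarePathAt ρ w) →
    a ≤ ℓ → b ≤ ℓ → ancestor a v ≡ ancestor b w → v ≡ w
  startsBarePathAt-disjoint {ρ} {v} {w} a b hv hw a≤ℓ b≤ℓ e =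
    ancestor-injective-on-chains a v w a≤dv a≤dw
      (λ m 1≤m m≤a → unaryChain-children (startsBarePath-chain bv) m 1≤m (≤-trans m≤a a≤ℓ))
      (trans e (cong (λ k → ancestor k w) (sym a≡b)))
    where
    bv : T (startsBarePath v)
    bv = proj₁ (∧-elim hv)
    bw : T (startsBarePath w)
    bw = proj₁ (∧-elim hw)
    a≤dv : a ≤ depth v
    a≤dv = ≤-trans a≤ℓ (<⇒≤ (ℓ<depth bv))
    b≤dw : b ≤ depth w
    b≤dw = ≤-trans b≤ℓ (<⇒≤ (ℓ<depth bw))
    meet : depth v ∸ a ≡ depth w ∸ b
    meet = trans (sym (depth-ancestor a v)) (trans (cong depth e) (depth-ancestor b w))
    same-residue : depth v % suc ℓ ≡ depth w % suc ℓ
    same-residue = trans (startsBarePathAt-residue hv) (sym (startsBarePathAt-residue hw))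
    a≡b : a ≡ b
    a≡b with ≤-total a b
    ... | inj₁ a≤b = same-offset (depth v) (depth w) a b a≤b b≤ℓ a≤dv b≤dw meet same-residue
    ... | inj₂ b≤a = sym (same-offset (depth w) (depth v) b a b≤a a≤ℓ b≤dw a≤dv (sym meet) (sym same-residue))
    a≤dw : a ≤ depth w
    a≤dw = subst (_≤ depth w) (sym a≡b) b≤dw

  disjointBarePaths : ∀ ρ → DisjointBarePaths G ℓ (count (startsBarePathAt ρ))
  disjointBarePaths ρ = record
    { path = λ a → upwardPath (enumerate (startsBarePathAt ρ) a)
    ; bare = λ a → upwardPath-bare (proj₁ (∧-elim (enumerate-sound (startsBarePathAt ρ) a)))
    ; disjoint = λ a b i j e → enumerate-injective (startsBarePathAt ρ) a b
        (startsBarePathAt-disjoint (toℕ i) (toℕ j)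
          (enumerate-sound (startsBarePathAt ρ) a) (enumerate-sound (startsBarePathAt ρ) b)
          (≤-pred (toℕ<n i)) (≤-pred (toℕ<n j)) e)
    }

  startsBarePath-cover : count startsBarePath ≤ ∑ (λ ρ → count (startsBarePathAt ρ))
  startsBarePath-cover = count-cover startsBarePath startsBarePathAt
    (λ v h → depth v mod suc ℓ , ∧-intro h (==-refl (depth v mod suc ℓ)))

  firstNonUnary : ∀ {v} → ¬ T (startsBarePath v) → v ≢ r →
    Σ ℕ λ m → m < ℓ × T (nonUnary (ancestor (suc m) v)) × T (unaryChain m v)
  firstNonUnary {v} not-bare v≢r with least-< (λ i → nonUnary (ancestor (suc i) v)) ℓ
  ... | inj₁ (m , m<ℓ , hm , minimal) = m , m<ℓ , hm , allBelow⁺ m _ (λ i i<m → not-intro (minimal i i<m))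
  ... | inj₂ none = ⊥-elim (not-bare (∧-intro (<⇒<ᵇ (≰⇒> shallow⇒root)) (allBelow⁺ ℓ _ (λ i i<ℓ → not-intro (none i i<ℓ)))))
    where
    shallow⇒root : ¬ depth v ≤ ℓ
    shallow⇒root dv≤ℓ = none (depth (parent v)) (subst (_≤ ℓ) dv dv≤ℓ)
      (∨-introˡ (≡⇒== (trans (cong (λ k → ancestor k v) (sym dv)) (ancestor-depth v))))
      where
      dv : depth v ≡ suc (depth (parent v))
      dv = depth-nonroot v≢r

module Pieces {n : ℕ} (tree : Tree n) (r : Fin n) where

  open import Data.Nat hiding (_≟_)
  open import Data.Nat.Properties hiding (_≟_)
  open import Data.Bool using (Bool; true; false; T; not; _∧_; _∨_)
  open import Data.Fin using (toℕ; _≟_)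
  open import Data.Fin.Properties using (toℕ-injective; toℕ<n)
  open import Relation.Binary.Definitions using (tri<; tri≈; tri>)
  open import Data.Product using (Σ; ∃; _×_; _,_; proj₁; proj₂)
  open import Data.Sum using (_⊎_; inj₁; inj₂)
  open import Data.Empty using (⊥-elim)
  open import Data.Unit using (tt)
  open import Relation.Nullary using (¬_; yes; no; Dec)
  open import Relation.Binary.PropositionalEquality
  open import Data.Nat.Solver using (module +-*-Solver)
  open import Defs hiding (sym; Tree)
  open Counting
  open RootedTree tree r

  isDescendant : Fin n → Fin n → Bool
  isDescendant u v = (depth u ≤ᵇ depth v) ∧ (ancestorAt (depth u) v == u)

  subtreeSize : Fin n → ℕ
  subtreeSize u = count (isDescendant u)

  isDescendant-root : ∀ v → T (isDescendant r v)
  isDescendant-root v = ∧-intro (≤⇒≤ᵇ (subst (_≤ depth v) (sym depth-root) z≤n))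
    (≡⇒== (trans (cong (λ d → ancestorAt d v) depth-root) (ancestor-depth v)))

  subtreeSize-root : subtreeSize r ≡ n
  subtreeSize-root = trans (count-cong {n} {isDescendant r} {λ _ → true} (λ _ _ → tt) (λ v _ → isDescendant-root v))
                           count-all

  childSubtrees : Fin n → ℕ → ℕ
  childSubtrees t J = ∑ (λ c → χ (isChild t c ∧ (toℕ c <ᵇ J)) * subtreeSize c)

  -- The candidate subtree T′ = S: t together with the subtrees of its children c with toℕ c < J.
  module Piece (t : Fin n) (J : ℕ) where

    dt : ℕ
    dt = depth t

    top : Fin n → Fin n
    top v = ancestorAt (suc dt) v

    inS : Fin n → Bool
    inS v = (v == t) ∨ ((dt <ᵇ depth v) ∧ ((ancestorAt dt v == t) ∧ (toℕ (top v) <ᵇ J)))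

    below : Fin n → Bool
    below v = inS v ∧ (dt <ᵇ depth v)

    t∈S : T (inS t)
    t∈S = ∨-introˡ (==-refl t)

    S⁻ : ∀ {v} → T (inS v) → v ≡ t ⊎ (dt < depth v × ancestorAt dt v ≡ t × toℕ (top v) < J)
    S⁻ {v} h with ∨-elim h
    ... | inj₁ v≡t = inj₁ (==⇒≡ v≡t)
    ... | inj₂ h′ with ∧-elim {dt <ᵇ depth v} h′
    ... | deeper , h″ with ∧-elim {ancestorAt dt v == t} h″
    ... | at-t , first = inj₂ (<ᵇ⇒< dt (depth v) deeper , ==⇒≡ at-t , <ᵇ⇒< (toℕ (top v)) J first)

    S⁺ : ∀ {v} → dt < depth v → ancestorAt dt v ≡ t → toℕ (top v) < J → T (inS v)
    S⁺ {v} deeper at-t first = ∨-introʳ {v == t} (∧-intro (<⇒<ᵇ deeper) (∧-intro (≡⇒== at-t) (<⇒<ᵇ first)))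

    S-ancestorAt : ∀ {v} → T (inS v) → ancestorAt dt v ≡ t
    S-ancestorAt h with S⁻ h
    ... | inj₁ refl = ancestorAt-depth t
    ... | inj₂ (_ , at-t , _) = at-t

    S-depth : ∀ {v} → T (inS v) → v ≢ t → dt < depth v
    S-depth h v≢t with S⁻ h
    ... | inj₁ v≡t = ⊥-elim (v≢t v≡t)
    ... | inj₂ (deeper , _ , _) = deeper

    deeper⇒≢root : ∀ {v} → dt < depth v → v ≢ r
    deeper⇒≢root {v} deeper = 0<depth⇒≢root (≤-trans (s≤s z≤n) deeper)

    below⁻ : ∀ {x} → T (below x) → T (inS x) × dt < depth x
    below⁻ {x} h = proj₁ (∧-elim h) , <ᵇ⇒< dt (depth x) (proj₂ (∧-elim {inS x} h))

    below-≢t : ∀ {x} → T (below x) → x ≢ t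
    below-≢t h refl = <-irrefl refl (proj₂ (below⁻ h))

    S-ancestor : ∀ {v} k → T (inS v) → dt < depth (ancestor k v) → T (inS (ancestor k v))
    S-ancestor {v} k h deeper with S⁻ h
    ... | inj₁ refl = ⊥-elim (<⇒≱ deeper (subst (_≤ dt) (sym (depth-ancestor k t)) (m∸n≤m dt k)))
    ... | inj₂ (_ , at-t , first) = S⁺ deeper (trans (ancestorAt-ancestor {dt} {k} {v} (≤-trans (+-monoˡ-≤ k (<⇒≤ dt<dv∸k)) k+room)) at-t)
        (subst (λ z → toℕ z < J) (sym (ancestorAt-ancestor {suc dt} {k} {v} (≤-trans (+-monoˡ-≤ k dt<dv∸k) k+room))) first)
      where
      dt<dv∸k : dt < depth v ∸ k
      dt<dv∸k = subst (dt <_) (depth-ancestor k v) deeper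
      k≤dv : k ≤ depth v
      k≤dv = ≮⇒≥ (λ dv<k → <⇒≱ dt<dv∸k (subst (_≤ dt) (sym (m≤n⇒m∸n≡0 (<⇒≤ dv<k))) z≤n))
      k+room : depth v ∸ k + k ≤ depth v
      k+room = ≤-reflexive (m∸n+n≡m k≤dv)

    S-parent : ∀ {x} → T (inS x) → x ≢ t → T (inS (parent x))
    S-parent {x} h x≢t with dt <? depth (parent x)
    ... | yes deeper = S-ancestor 1 h deeper
    ... | no ¬deeper = subst (λ z → T (inS z)) (sym parent≡t) t∈S
      where
      dx≡1+dt : depth x ≡ suc dt
      dx≡1+dt = ≤-antisym (subst (_≤ suc dt) (sym (depth-nonroot (deeper⇒≢root (S-depth h x≢t))))
                                  (s≤s (≮⇒≥ ¬deeper)))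
                          (S-depth h x≢t)
      parent≡t : parent x ≡ t
      parent≡t = trans (cong (λ k → ancestor k x) (sym (trans (cong (_∸ dt) dx≡1+dt) (m+n∸n≡m 1 dt))))
                       (S-ancestorAt h)

    S-child : ∀ {x} → T (inS (parent x)) → parent x ≢ t → x ≢ r → T (inS x)
    S-child {x} h px≢t x≢r with S⁻ h
    ... | inj₁ px≡t = ⊥-elim (px≢t px≡t)
    ... | inj₂ (deeper , at-t , first) =
      S⁺ dt<dx (trans (ancestorAt-parent dt<dx) at-t)
         (subst (λ z → toℕ z < J) (sym (ancestorAt-parent (subst (suc dt <_) (sym dx) (s≤s deeper)))) first)
      where
      dx : depth x ≡ suc (depth (parent x))
      dx = depth-nonroot x≢r
      dt<dx : dt < depth x
      dt<dx = subst (dt <_) (sym dx) (≤-trans deeper (n≤1+n _))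

    childrenIn : Fin n → ℕ
    childrenIn u = count (λ x → below x ∧ (parent x == u))

    count-S : count inS ≡ suc (∑ childrenIn)
    count-S = begin
      count inS
        ≡⟨ count-split inS (λ x → dt <ᵇ depth x) ⟩
      count below + count (λ x → inS x ∧ not (dt <ᵇ depth x))
        ≡⟨ cong₂ _+_ (count-fibres below parent) (trans (count-cong only-t is-t) (count-== t)) ⟩
      ∑ childrenIn + 1
        ≡⟨ +-comm (∑ childrenIn) 1 ⟩
      suc (∑ childrenIn) ∎
      where
      open ≡-Reasoning
      only-t : ∀ x → T (inS x ∧ not (dt <ᵇ depth x)) → T (x == t)
      only-t x h = by-cases (x ≟ t)
        where
        by-cases : Dec (x ≡ t) → T (x == t)
        by-cases (yes x≡t) = ≡⇒== x≡t
        by-cases (no x≢t) = ⊥-elim (not-elim (proj₂ (∧-elim h)) (<⇒<ᵇ (S-depth (proj₁ (∧-elim h)) x≢t)))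
      is-t : ∀ x → T (x == t) → T (inS x ∧ not (dt <ᵇ depth x))
      is-t x h = subst (λ z → T (inS z ∧ not (dt <ᵇ depth z))) (sym (==⇒≡ h))
                   (∧-intro t∈S (not-intro (λ q → <-irrefl refl (<ᵇ⇒< dt dt q))))

    childrenIn-outside : ∀ u → childrenIn u ≡ χ (inS u) * childrenIn u
    childrenIn-outside u with inS u in e
    ... | true = sym (+-identityʳ (childrenIn u))
    ... | false = count-none {n} {λ x → below x ∧ (parent x == u)} outside
      where
      outside : ∀ x → ¬ T (below x ∧ (parent x == u))
      outside x h with ∧-elim {below x} h
      ... | bx , px≡u = subst T e (subst (λ z → T (inS z)) (==⇒≡ px≡u)
                          (S-parent (proj₁ (below⁻ bx)) (below-≢t bx)))

    childrenIn-inner : ∀ {u} → T (inS u) → u ≢ t → childrenIn u ≡ children u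
    childrenIn-inner {u} hu u≢t = count-cong to from
      where
      to : ∀ x → T (below x ∧ (parent x == u)) → T (isChild u x)
      to x h = isChild⁺ (deeper⇒≢root (proj₂ (below⁻ (proj₁ (∧-elim h))))) (==⇒≡ (proj₂ (∧-elim h)))
      from : ∀ x → T (isChild u x) → T (below x ∧ (parent x == u))
      from x h with isChild⁻ h
      ... | x≢r , refl = ∧-intro (∧-intro x∈S (<⇒<ᵇ dt<dx)) (==-refl (parent x))
        where
        x∈S : T (inS x)
        x∈S = S-child hu u≢t x≢r
        dt<dx : dt < depth x
        dt<dx = subst (dt <_) (sym (depth-nonroot x≢r)) (≤-trans (S-depth hu u≢t) (n≤1+n _))

    childrenIn-t : childrenIn t ≤ children t
    childrenIn-t = count-mono {n} {λ x → below x ∧ (parent x == t)} {isChild t}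
      (λ x h → isChild⁺ (deeper⇒≢root (proj₂ (below⁻ (proj₁ (∧-elim {below x} h))))) (==⇒≡ (proj₂ (∧-elim {below x} h))))

    top-child : ∀ {v} → T (below v) → T (isChild t (top v))
    top-child {v} h with below⁻ h
    ... | v∈S , dt<dv = isChild⁺ (0<depth⇒≢root (subst (0 <_) (sym (depth-ancestorAt dt<dv)) (s≤s z≤n)))
                                 (trans (sym (ancestorAt-suc dt<dv)) (S-ancestorAt v∈S))

    top-first : ∀ {v} → T (below v) → toℕ (top v) < J
    top-first {v} h with S⁻ (proj₁ (below⁻ h))
    ... | inj₁ v≡t = ⊥-elim (below-≢t h v≡t)
    ... | inj₂ (_ , _ , first) = first

    below-top : ∀ c → count (λ v → below v ∧ (top v == c)) ≡ χ (isChild t c ∧ (toℕ c <ᵇ J)) * subtreeSize c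
    below-top c with isChild t c ∧ (toℕ c <ᵇ J) in e
    ... | false = count-none (λ v h → subst T e (subst (λ z → T (isChild t z ∧ (toℕ z <ᵇ J)))
                    (==⇒≡ (proj₂ (∧-elim {below v} h)))
                    (∧-intro (top-child (proj₁ (∧-elim {below v} h))) (<⇒<ᵇ (top-first (proj₁ (∧-elim {below v} h)))))))
    ... | true = trans (count-cong to from) (sym (+-identityʳ (subtreeSize c)))
      where
      c-first : T (isChild t c ∧ (toℕ c <ᵇ J))
      c-first = T-≡true e
      dc : depth c ≡ suc dt
      dc = isChild-depth (proj₁ (∧-elim c-first))
      to : ∀ v → T (below v ∧ (top v == c)) → T (isDescendant c v)
      to v h with ∧-elim {below v} h
      ... | bv , tv≡c = ∧-intro (≤⇒≤ᵇ (subst (_≤ depth v) (sym dc) (proj₂ (below⁻ bv))))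
                                (≡⇒== (trans (cong (λ d → ancestorAt d v) dc) (==⇒≡ tv≡c)))
      from : ∀ v → T (isDescendant c v) → T (below v ∧ (top v == c))
      from v h with ∧-elim {depth c ≤ᵇ depth v} h
      ... | dc≤dv , at-c = ∧-intro (∧-intro (S⁺ dt<dv at-t (subst (λ z → toℕ z < J) (sym tv≡c) c<J)) (<⇒<ᵇ dt<dv))
                                   (≡⇒== tv≡c)
        where
        dt<dv : dt < depth v
        dt<dv = subst (_≤ depth v) dc (≤ᵇ⇒≤ (depth c) (depth v) dc≤dv)
        tv≡c : top v ≡ c
        tv≡c = trans (cong (λ d → ancestorAt d v) (sym dc)) (==⇒≡ at-c)
        at-t : ancestorAt dt v ≡ t
        at-t = trans (ancestorAt-suc dt<dv) (trans (cong parent tv≡c) (proj₂ (isChild⁻ (proj₁ (∧-elim c-first)))))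
        c<J : toℕ c < J
        c<J = <ᵇ⇒< (toℕ c) J (proj₂ (∧-elim c-first))

    count-S-childSubtrees : count inS ≡ suc (childSubtrees t J)
    count-S-childSubtrees = trans count-S (cong suc (begin
      ∑ childrenIn                                ≡⟨ count-fibres below parent ⟨
      count below                                 ≡⟨ count-fibres below top ⟩
      ∑ (λ c → count (λ v → below v ∧ (top v == c))) ≡⟨ ∑-cong below-top ⟩
      childSubtrees t J                            ∎))
      where open ≡-Reasoning

    childlessIn : Fin n → Bool
    childlessIn u = inS u ∧ (childrenIn u ≡ᵇ 0)

    leafBelow : Fin n → Bool
    leafBelow u = (inS u ∧ not (u == t)) ∧ (children u ≡ᵇ 0)

    branchingIn : ℕ
    branchingIn = ∑ (λ u → χ (inS u ∧ (1 <ᵇ childrenIn u)) * childrenIn u)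

    private
      branching-pointwise : ∀ s c → χ (s ∧ (1 <ᵇ c)) * c + 2 * χ s ≤ 2 * (χ s * c) + 2 * χ (s ∧ (c ≡ᵇ 0))
      branching-pointwise false c = z≤n
      branching-pointwise true zero = ≤-refl
      branching-pointwise true (suc zero) = ≤-refl
      branching-pointwise true (suc (suc b)) = subst₂ _≤_ (sym (lhs b)) (sym (rhs b)) (m≤m+n (4 + b) b)
        where
        open +-*-Solver
        lhs : ∀ b → 1 * suc (suc b) + 2 * 1 ≡ 4 + b
        lhs = solve 1 (λ b → con 1 :* (con 2 :+ b) :+ con 2 :* con 1 := con 4 :+ b) refl
        rhs : ∀ b → 2 * (1 * suc (suc b)) + 2 * 0 ≡ 4 + b + b
        rhs = solve 1 (λ b → con 2 :* (con 1 :* (con 2 :+ b)) :+ con 2 :* con 0 := con 4 :+ b :+ b) refl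

    -- Summing the pointwise bound and using ∑ childrenIn = |S| - 1 (count-S): the children
    -- of branching vertices of S number at most twice its childless vertices, minus 2.
    branchingIn-≤ : branchingIn + 2 ≤ 2 * count childlessIn
    branchingIn-≤ = +-cancelʳ-≤ (2 * ∑ childrenIn) (branchingIn + 2) (2 * count childlessIn) (begin
      branchingIn + 2 + 2 * ∑ childrenIn
        ≡⟨ +-assoc branchingIn 2 _ ⟩
      branchingIn + (2 + 2 * ∑ childrenIn)
        ≡⟨ cong (branchingIn +_) (*-distribˡ-+ 2 1 (∑ childrenIn)) ⟨
      branchingIn + 2 * suc (∑ childrenIn)
        ≡⟨ cong (λ z → branchingIn + 2 * z) count-S ⟨
      branchingIn + 2 * count inS
        ≡⟨ cong (branchingIn +_) (∑-*ˡ 2 (λ u → χ (inS u))) ⟨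
      branchingIn + ∑ (λ u → 2 * χ (inS u))
        ≡⟨ ∑-+ (λ u → χ (inS u ∧ (1 <ᵇ childrenIn u)) * childrenIn u) (λ u → 2 * χ (inS u)) ⟨
      ∑ (λ u → χ (inS u ∧ (1 <ᵇ childrenIn u)) * childrenIn u + 2 * χ (inS u))
        ≤⟨ ∑-mono (λ u → branching-pointwise (inS u) (childrenIn u)) ⟩
      ∑ (λ u → 2 * (χ (inS u) * childrenIn u) + 2 * χ (childlessIn u))
        ≡⟨ ∑-+ (λ u → 2 * (χ (inS u) * childrenIn u)) (λ u → 2 * χ (childlessIn u)) ⟩
      ∑ (λ u → 2 * (χ (inS u) * childrenIn u)) + ∑ (λ u → 2 * χ (childlessIn u))
        ≡⟨ cong₂ _+_ (∑-*ˡ 2 (λ u → χ (inS u) * childrenIn u)) (∑-*ˡ 2 (λ u → χ (childlessIn u))) ⟩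
      2 * ∑ (λ u → χ (inS u) * childrenIn u) + 2 * count childlessIn
        ≡⟨ cong (λ z → 2 * z + 2 * count childlessIn) (∑-cong childrenIn-outside) ⟨
      2 * ∑ childrenIn + 2 * count childlessIn
        ≡⟨ +-comm (2 * ∑ childrenIn) _ ⟩
      2 * count childlessIn + 2 * ∑ childrenIn ∎)
      where open ≤-Reasoning

    childlessIn-≤ : count childlessIn ≤ 1 + count leafBelow
    childlessIn-≤ = ≤-trans (count-∪ childlessIn (_== t) leafBelow t-or-leaf)
                            (≤-reflexive (cong (_+ count leafBelow) (count-== t)))
      where
      t-or-leaf : ∀ u → T (childlessIn u) → T (u == t) ⊎ T (leafBelow u)
      t-or-leaf u h = by-cases (u ≟ t)
        where
        by-cases : Dec (u ≡ t) → T (u == t) ⊎ T (leafBelow u)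
        by-cases (yes u≡t) = inj₁ (≡⇒== u≡t)
        by-cases (no u≢t) with ∧-elim {inS u} h
        ... | u∈S , none = inj₂ (∧-intro (∧-intro u∈S (not-intro (λ q → u≢t (==⇒≡ q))))
            (≡⇒≡ᵇ (children u) 0 (trans (sym (childrenIn-inner u∈S u≢t)) (≡ᵇ⇒≡ (childrenIn u) 0 none))))

    belowNonUnary : Fin n → Bool
    belowNonUnary x = below x ∧ nonUnary (parent x)

    belowNonUnary-fibre : ∀ u → count (λ x → belowNonUnary x ∧ (parent x == u)) ≤
      χ (u == t) * childrenIn u + χ (inS u ∧ (1 <ᵇ childrenIn u)) * childrenIn u
    belowNonUnary-fibre u = by-cases (u ≟ t)
      where
      Q : Fin n → Bool
      Q x = belowNonUnary x ∧ (parent x == u)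
      Q≤ : count Q ≤ childrenIn u
      Q≤ = count-mono {n} {Q} {λ x → below x ∧ (parent x == u)}
        (λ x h → ∧-intro (proj₁ (∧-elim {below x} (proj₁ (∧-elim {belowNonUnary x} h)))) (proj₂ (∧-elim {belowNonUnary x} h)))
      by-cases : Dec (u ≡ t) → count Q ≤ χ (u == t) * childrenIn u + χ (inS u ∧ (1 <ᵇ childrenIn u)) * childrenIn u
      by-cases (yes u≡t) = ≤-trans Q≤ (≤-trans (≤-reflexive (trans (sym (*-identityˡ (childrenIn u)))
                             (cong (_* childrenIn u) (sym (χ-true (≡⇒== u≡t)))))) (m≤m+n _ _))
      by-cases (no u≢t) = ≤-trans (count-≤-χ* Q (inS u ∧ (1 <ᵇ childrenIn u)) (childrenIn u) Q≤ branching) (m≤n+m _ _)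
        where
        branching : ∀ x → T (Q x) → T (inS u ∧ (1 <ᵇ childrenIn u))
        branching x h with ∧-elim {belowNonUnary x} h
        ... | bx , px≡u with ∧-elim {below x} bx
        ... | b , non-unary = ∧-intro u∈S (<⇒<ᵇ (≤∧≢⇒< 1≤ (λ e → ≠1 (trans (sym (childrenIn-inner u∈S u≢t)) (sym e)))))
          where
          p≡u : parent x ≡ u
          p≡u = ==⇒≡ px≡u
          u∈S : T (inS u)
          u∈S = subst (λ z → T (inS z)) p≡u (S-parent (proj₁ (below⁻ b)) (below-≢t b))
          ≠1 : children u ≢ 1
          ≠1 one with ∨-elim (subst (λ z → T (nonUnary z)) p≡u non-unary)
          ... | inj₁ u≡r = deeper⇒≢root (S-depth u∈S u≢t) (==⇒≡ u≡r)
          ... | inj₂ not-one = not-elim not-one (≡⇒≡ᵇ (children u) 1 one)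
          1≤ : 1 ≤ childrenIn u
          1≤ = count-point (λ y → below y ∧ (parent y == u)) x (∧-intro b px≡u)

    count-belowNonUnary : count belowNonUnary ≤ Δ + 2 * count leafBelow
    count-belowNonUnary = begin
      count belowNonUnary
        ≡⟨ count-fibres belowNonUnary parent ⟩
      ∑ (λ u → count (λ x → belowNonUnary x ∧ (parent x == u)))
        ≤⟨ ∑-mono belowNonUnary-fibre ⟩
      ∑ (λ u → χ (u == t) * childrenIn u + χ (inS u ∧ (1 <ᵇ childrenIn u)) * childrenIn u)
        ≡⟨ ∑-+ (λ u → χ (u == t) * childrenIn u) (λ u → χ (inS u ∧ (1 <ᵇ childrenIn u)) * childrenIn u) ⟩
      ∑ (λ u → χ (u == t) * childrenIn u) + branchingIn
        ≡⟨ cong (_+ branchingIn) (∑-select t childrenIn) ⟩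
      childrenIn t + branchingIn
        ≤⟨ +-mono-≤ (≤-trans childrenIn-t (children≤Δ t)) branchingIn≤ ⟩
      Δ + 2 * count leafBelow ∎
      where
      open ≤-Reasoning
      branchingIn≤ : branchingIn ≤ 2 * count leafBelow
      branchingIn≤ = +-cancelʳ-≤ 2 branchingIn (2 * count leafBelow) (begin
        branchingIn + 2                ≤⟨ branchingIn-≤ ⟩
        2 * count childlessIn          ≤⟨ *-monoʳ-≤ 2 childlessIn-≤ ⟩
        2 * (1 + count leafBelow)      ≡⟨ *-distribˡ-+ 2 1 (count leafBelow) ⟩
        2 + 2 * count leafBelow        ≡⟨ +-comm 2 _ ⟩
        2 * count leafBelow + 2        ∎)

    leafBelow⁻ : ∀ {y} → T (leafBelow y) → T (inS y) × y ≢ t × children y ≡ 0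
    leafBelow⁻ {y} h with ∧-elim {inS y ∧ not (y == t)} h
    ... | h′ , none with ∧-elim {inS y} h′
    ... | y∈S , y≠t = y∈S , (λ e → not-elim y≠t (≡⇒== e)) , ≡ᵇ⇒≡ (children y) 0 none

    leafBelow-≢root : ∀ {y} → T (leafBelow y) → y ≢ r
    leafBelow-≢root h with leafBelow⁻ h
    ... | y∈S , y≢t , _ = deeper⇒≢root (S-depth y∈S y≢t)

    leafBelow-isLeaf : ∀ {y} → T (leafBelow y) → T (isLeaf G y)
    leafBelow-isLeaf h = childless⇒leaf (leafBelow-≢root h) (proj₂ (proj₂ (leafBelow⁻ h)))

    count-leafBelow-≤-numLeaves : count leafBelow ≤ numLeaves G
    count-leafBelow-≤-numLeaves = ≤-trans (count-mono {n} {leafBelow} {isLeaf G} (λ y → leafBelow-isLeaf))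
                                          (≤-reflexive (sym (countB-allFin (isLeaf G))))

    leafParent : Fin n → Bool
    leafParent u = inS u ∧ inNbrLeaves G u

    leafBelow-fibre : ∀ u → count (λ y → leafBelow y ∧ (parent y == u)) ≤ χ (leafParent u) * Δ + χ (u == r) * Δ
    leafBelow-fibre u = by-cases (u ≟ r)
      where
      Q : Fin n → Bool
      Q y = leafBelow y ∧ (parent y == u)
      Q≤Δ : count Q ≤ Δ
      Q≤Δ = ≤-trans (count-mono {n} {Q} {isChild u}
                      (λ y h → isChild⁺ (leafBelow-≢root (proj₁ (∧-elim {leafBelow y} h))) (==⇒≡ (proj₂ (∧-elim {leafBelow y} h)))))
                    (children≤Δ u)
      by-cases : Dec (u ≡ r) → count Q ≤ χ (leafParent u) * Δ + χ (u == r) * Δ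
      by-cases (yes u≡r) = ≤-trans Q≤Δ (≤-trans (≤-reflexive (trans (sym (*-identityˡ Δ))
                             (cong (_* Δ) (sym (χ-true (≡⇒== u≡r)))))) (m≤n+m _ _))
      by-cases (no u≢r) = ≤-trans (count-≤-χ* Q (leafParent u) Δ Q≤Δ parent-of-leaf) (m≤m+n _ _)
        where
        parent-of-leaf : ∀ y → T (Q y) → T (leafParent u)
        parent-of-leaf y h with ∧-elim {leafBelow y} h
        ... | ly , py≡u with leafBelow⁻ ly
        ... | y∈S , y≢t , _ = ∧-intro u∈S (∧-intro (not-intro u-not-leaf)
                                 (any-allFin⁺ (λ w → isLeaf G w ∧ adj G w u) y (∧-intro (leafBelow-isLeaf ly) (~-sym (isChild-~ y-child)))))
          where
          y-child : T (isChild u y)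
          y-child = isChild⁺ (leafBelow-≢root ly) (==⇒≡ py≡u)
          u∈S : T (inS u)
          u∈S = subst (λ z → T (inS z)) (==⇒≡ py≡u) (S-parent y∈S y≢t)
          u-not-leaf : ¬ T (isLeaf G u)
          u-not-leaf leaf = <⇒≢ (isChild-count y-child) (sym (leaf⇒childless u≢r leaf))

    count-leafBelow : count leafBelow ≤ Δ * count leafParent + Δ
    count-leafBelow = begin
      count leafBelow
        ≡⟨ count-fibres leafBelow parent ⟩
      ∑ (λ u → count (λ y → leafBelow y ∧ (parent y == u)))
        ≤⟨ ∑-mono leafBelow-fibre ⟩
      ∑ (λ u → χ (leafParent u) * Δ + χ (u == r) * Δ)
        ≡⟨ ∑-+ (λ u → χ (leafParent u) * Δ) (λ u → χ (u == r) * Δ) ⟩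
      ∑ (λ u → χ (leafParent u) * Δ) + ∑ (λ u → χ (u == r) * Δ)
        ≡⟨ cong₂ _+_ (trans (∑-cong (λ u → *-comm (χ (leafParent u)) Δ)) (∑-*ˡ Δ (λ u → χ (leafParent u))))
                     (∑-select r (λ _ → Δ)) ⟩
      Δ * count leafParent + Δ ∎
      where open ≤-Reasoning

  module _ (A : ℕ) (2A<n : 2 * A < n) where

    heavyAt : ℕ → Bool
    heavyAt d = 0 <ᵇ count (λ v → (depth v ≡ᵇ d) ∧ (2 * A <ᵇ subtreeSize v))

    private
      depthBound : ℕ
      depthBound = ∑ depth

    opaque
      private
        deepest : Σ ℕ λ d → d ≤ depthBound × T (heavyAt d) × (∀ j → d < j → j ≤ depthBound → ¬ T (heavyAt j))
        deepest = greatest-≤ heavyAt depthBound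
          (<⇒<ᵇ (count-point _ r (∧-intro (≡⇒≡ᵇ (depth r) 0 depth-root)
                                          (<⇒<ᵇ (subst (2 * A <_) (sym subtreeSize-root) 2A<n)))))

        d₀ : ℕ
        d₀ = proj₁ deepest

        heavy-witness : ∃ λ v → T ((depth v ≡ᵇ d₀) ∧ (2 * A <ᵇ subtreeSize v))
        heavy-witness = count-witness _ (<ᵇ⇒< 0 _ (proj₁ (proj₂ (proj₂ deepest))))

      heavy : Fin n
      heavy = proj₁ heavy-witness

      heavy-big : 2 * A < subtreeSize heavy
      heavy-big = <ᵇ⇒< (2 * A) _ (proj₂ (∧-elim {depth heavy ≡ᵇ d₀} (proj₂ heavy-witness)))

      heavy-children-small : ∀ c → T (isChild heavy c) → subtreeSize c ≤ 2 * A
      heavy-children-small c h = ≮⇒≥ (λ big → proj₂ (proj₂ (proj₂ deepest)) (suc d₀) ≤-refl dc≤bound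
          (<⇒<ᵇ (count-point _ c (∧-intro (≡⇒≡ᵇ (depth c) (suc d₀) dc) (<⇒<ᵇ big)))))
        where
        dc : depth c ≡ suc d₀
        dc = trans (isChild-depth h) (cong suc (≡ᵇ⇒≡ (depth heavy) d₀ (proj₁ (∧-elim (proj₂ heavy-witness)))))
        dc≤bound : suc d₀ ≤ depthBound
        dc≤bound = subst (_≤ depthBound) dc (∑-point depth c)

    childSubtrees-zero : childSubtrees heavy 0 ≡ 0
    childSubtrees-zero = trans (∑-cong none) (∑-zero {n})
      where
      none : ∀ c → χ (isChild heavy c ∧ (toℕ c <ᵇ 0)) * subtreeSize c ≡ 0
      none c with isChild heavy c
      ... | false = refl
      ... | true = refl

    childSubtrees-suc : ∀ J → childSubtrees heavy (suc J) ≤ childSubtrees heavy J + 2 * A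
    childSubtrees-suc J = begin
      childSubtrees heavy (suc J)
        ≤⟨ ∑-mono pointwise ⟩
      ∑ (λ c → χ (isChild heavy c ∧ (toℕ c <ᵇ J)) * subtreeSize c + χ (toℕ c ≡ᵇ J) * (2 * A))
        ≡⟨ ∑-+ (λ c → χ (isChild heavy c ∧ (toℕ c <ᵇ J)) * subtreeSize c) (λ c → χ (toℕ c ≡ᵇ J) * (2 * A)) ⟩
      childSubtrees heavy J + ∑ (λ (c : Fin n) → χ (toℕ c ≡ᵇ J) * (2 * A))
        ≤⟨ +-monoʳ-≤ (childSubtrees heavy J) index-J ⟩
      childSubtrees heavy J + 2 * A ∎
      where
      open ≤-Reasoning
      <ᵇ-true : ∀ {a b} → a < b → (a <ᵇ b) ≡ true
      <ᵇ-true a<b = T⇒≡true (<⇒<ᵇ a<b)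
      <ᵇ-false : ∀ {a b} → ¬ a < b → (a <ᵇ b) ≡ false
      <ᵇ-false {a} {b} a≮b = ¬T⇒≡false (λ h → a≮b (<ᵇ⇒< a b h))
      pointwise : ∀ c → χ (isChild heavy c ∧ (toℕ c <ᵇ suc J)) * subtreeSize c ≤
                        χ (isChild heavy c ∧ (toℕ c <ᵇ J)) * subtreeSize c + χ (toℕ c ≡ᵇ J) * (2 * A)
      pointwise c with isChild heavy c in ec
      ... | false = z≤n
      ... | true with <-cmp (toℕ c) J
      ... | tri< c<J _ _ rewrite <ᵇ-true {toℕ c} {suc J} (≤-trans c<J (n≤1+n J)) | <ᵇ-true c<J = m≤m+n _ _
      ... | tri≈ _ c≡J _ rewrite <ᵇ-true {toℕ c} {suc J} (s≤s (≤-reflexive c≡J)) | <ᵇ-false {toℕ c} {J} (<-irrefl c≡J)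
                               | T⇒≡true (≡⇒≡ᵇ (toℕ c) J c≡J) =
        ≤-trans (≤-reflexive (+-identityʳ (subtreeSize c)))
                (≤-trans (heavy-children-small c (T-≡true ec)) (≤-reflexive (sym (+-identityʳ (2 * A)))))
      ... | tri> _ _ c>J rewrite <ᵇ-false {toℕ c} {suc J} (λ c<1+J → <⇒≱ c>J (≤-pred c<1+J)) = z≤n
      index-J : ∑ (λ (c : Fin n) → χ (toℕ c ≡ᵇ J) * (2 * A)) ≤ 2 * A
      index-J = begin
        ∑ (λ (c : Fin n) → χ (toℕ c ≡ᵇ J) * (2 * A))  ≡⟨ ∑-cong {n} (λ c → *-comm (χ (toℕ c ≡ᵇ J)) (2 * A)) ⟩
        ∑ (λ (c : Fin n) → 2 * A * χ (toℕ c ≡ᵇ J))    ≡⟨ ∑-*ˡ (2 * A) (λ (c : Fin n) → χ (toℕ c ≡ᵇ J)) ⟩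
        2 * A * count (λ (c : Fin n) → toℕ c ≡ᵇ J)    ≤⟨ *-monoʳ-≤ (2 * A) (count-≤1 {n} _ same-index) ⟩
        2 * A * 1                                       ≡⟨ *-identityʳ (2 * A) ⟩
        2 * A                                           ∎
        where
        same-index : ∀ (a b : Fin n) → T (toℕ a ≡ᵇ J) → T (toℕ b ≡ᵇ J) → a ≡ b
        same-index a b ha hb = toℕ-injective (trans (≡ᵇ⇒≡ (toℕ a) J ha) (sym (≡ᵇ⇒≡ (toℕ b) J hb)))

    subtreeSize-heavy : subtreeSize heavy ≡ suc (childSubtrees heavy n)
    subtreeSize-heavy = trans (count-cong to from) (Piece.count-S-childSubtrees heavy n)
      where
      open Piece heavy n using (inS; S⁺; S⁻; t∈S; S-ancestorAt)
      to : ∀ v → T (isDescendant heavy v) → T (inS v)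
      to v h = by-cases (v ≟ heavy)
        where
        by-cases : Dec (v ≡ heavy) → T (inS v)
        by-cases (yes refl) = t∈S
        by-cases (no v≢t) with ∧-elim {depth heavy ≤ᵇ depth v} h
        ... | dt≤dv , at-t = S⁺ (≤∧≢⇒< (≤ᵇ⇒≤ (depth heavy) (depth v) dt≤dv) same-depth⇒≡) (==⇒≡ at-t) (toℕ<n _)
          where
          same-depth⇒≡ : depth heavy ≢ depth v
          same-depth⇒≡ e = v≢t (trans (sym (ancestorAt-depth v)) (trans (cong (λ d → ancestorAt d v) (sym e)) (==⇒≡ at-t)))
      from : ∀ v → T (inS v) → T (isDescendant heavy v)
      from v h = ∧-intro (≤⇒≤ᵇ dt≤dv) (≡⇒== (S-ancestorAt h))
        where
        dt≤dv : depth heavy ≤ depth v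
        dt≤dv with S⁻ h
        ... | inj₁ refl = ≤-refl
        ... | inj₂ (deeper , _ , _) = <⇒≤ deeper

    opaque
      private
        enough : Σ ℕ λ J → J ≤ n × T (A ≤ᵇ childSubtrees heavy J) × (∀ j → j < J → ¬ T (A ≤ᵇ childSubtrees heavy j))
        enough = least-≤ (λ J → A ≤ᵇ childSubtrees heavy J) n
          (≤⇒≤ᵇ (≤-trans (m≤m+n A (A + 0)) (≤-pred (subst (2 * A <_) subtreeSize-heavy heavy-big))))

      J₀ : ℕ
      J₀ = proj₁ enough

      childSubtrees-J₀ : A ≤ childSubtrees heavy J₀ × childSubtrees heavy J₀ ≤ 3 * A
      childSubtrees-J₀ = ≤ᵇ⇒≤ A _ (proj₁ (proj₂ (proj₂ enough))) , upper J₀ (proj₂ (proj₂ (proj₂ enough)))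
        where
        upper : ∀ J → (∀ j → j < J → ¬ T (A ≤ᵇ childSubtrees heavy j)) → childSubtrees heavy J ≤ 3 * A
        upper zero _ = subst (_≤ 3 * A) (sym childSubtrees-zero) z≤n
        upper (suc J) minimal = ≤-trans (childSubtrees-suc J) (+-monoˡ-≤ (2 * A) (<⇒≤ small))
          where
          small : childSubtrees heavy J < A
          small = ≰⇒> (λ A≤ → minimal J ≤-refl (≤⇒≤ᵇ A≤))

    piece-size : A + 1 ≤ count (Piece.inS heavy J₀) × count (Piece.inS heavy J₀) ≤ 3 * A + 1
    piece-size = subst (A + 1 ≤_) (sym size) (subst (_≤ suc (childSubtrees heavy J₀)) (+-comm 1 A) (s≤s (proj₁ childSubtrees-J₀)))
               , subst (_≤ 3 * A + 1) (sym size) (subst (suc (childSubtrees heavy J₀) ≤_) (+-comm 1 (3 * A)) (s≤s (proj₂ childSubtrees-J₀)))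
      where
      size : count (Piece.inS heavy J₀) ≡ suc (childSubtrees heavy J₀)
      size = Piece.count-S-childSubtrees heavy J₀

module NonBare {n : ℕ} (tree : Tree n) (r : Fin n) (ℓ : ℕ) (t : Fin n) (J : ℕ) where

  open import Data.Nat hiding (_≟_)
  open import Data.Nat.Properties hiding (_≟_)
  open import Data.Bool using (Bool; true; false; T; not; _∧_)
  open import Data.Fin using (toℕ; fromℕ<; _≟_)
  open import Data.Fin.Properties using (toℕ-fromℕ<)
  open import Data.Product using (Σ; ∃; _×_; _,_; proj₁; proj₂)
  open import Data.Sum using (_⊎_; inj₁; inj₂)
  open import Data.Empty using (⊥-elim)
  open import Data.Unit using (tt)
  open import Relation.Nullary using (¬_; yes; no; Dec)
  open import Relation.Binary.PropositionalEquality hiding (J)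
  open import Defs hiding (sym; Tree)
  open Counting
  open RootedTree tree r
  open BarePaths tree r ℓ
  open Pieces tree r
  open Piece t J

  nonRoot : Fin n → Bool
  nonRoot v = inS v ∧ not (v == r)

  nearTop : Fin n → Bool
  nearTop v = nonRoot v ∧ ((depth v ∸ dt <ᵇ ℓ) ∧ unaryChain (depth v ∸ dt) v)

  belowBreak : ℕ → Fin n → Bool
  belowBreak m v = nonRoot v ∧ (nonUnary (ancestor (suc m) v) ∧ (unaryChain m v ∧ (dt <ᵇ depth (ancestor m v))))

  nonRoot⁻ : ∀ {v} → T (nonRoot v) → T (inS v) × v ≢ r
  nonRoot⁻ {v} h = proj₁ (∧-elim h) , λ v≡r → not-elim (proj₂ (∧-elim {inS v} h)) (≡⇒== v≡r)

  classify : ∀ v → T (inS v) → ¬ T (startsBarePath v) →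
    v ≡ r ⊎ T (nearTop v) ⊎ Σ ℕ λ m → m < ℓ × T (belowBreak m v)
  classify v v∈S not-bare = by-cases (v ≟ r)
    where
    by-cases : Dec (v ≡ r) → v ≡ r ⊎ T (nearTop v) ⊎ Σ ℕ λ m → m < ℓ × T (belowBreak m v)
    by-cases (yes v≡r) = inj₁ v≡r
    by-cases (no v≢r) = inj₂ (by-depth (dt <? depth (ancestor m v)))
      where
      first : Σ ℕ λ m → m < ℓ × T (nonUnary (ancestor (suc m) v)) × T (unaryChain m v)
      first = firstNonUnary not-bare v≢r
      m : ℕ
      m = proj₁ first
      m<ℓ : m < ℓ
      m<ℓ = proj₁ (proj₂ first)
      break : T (nonUnary (ancestor (suc m) v))
      break = proj₁ (proj₂ (proj₂ first))
      chain : T (unaryChain m v)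
      chain = proj₂ (proj₂ (proj₂ first))
      v-nonRoot : T (nonRoot v)
      v-nonRoot = ∧-intro v∈S (not-intro (λ q → v≢r (==⇒≡ q)))
      by-depth : Dec (dt < depth (ancestor m v)) → T (nearTop v) ⊎ Σ ℕ λ m → m < ℓ × T (belowBreak m v)
      by-depth (yes deeper) = inj₂ (m , m<ℓ , ∧-intro v-nonRoot (∧-intro break (∧-intro chain (<⇒<ᵇ deeper))))
      by-depth (no shallow) = inj₁ (∧-intro v-nonRoot (∧-intro (<⇒<ᵇ (≤-<-trans offset≤m m<ℓ))
                                (allBelow⁺ (depth v ∸ dt) _ (λ i i< → allBelow⁻ m _ chain i (≤-trans i< offset≤m)))))
        where
        offset≤m : depth v ∸ dt ≤ m
        offset≤m = m≤n+o⇒m∸n≤o (depth v) dt (≤-trans (m≤n+m∸n (depth v) m)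
                     (≤-trans (+-monoʳ-≤ m (subst (_≤ dt) (depth-ancestor m v) (≮⇒≥ shallow))) (≤-reflexive (+-comm m dt))))

  count-nearTop : count nearTop ≤ ℓ
  count-nearTop = begin
    count nearTop                          ≤⟨ count-cover nearTop atOffset by-offset ⟩
    ∑ (λ j → count (atOffset j))           ≤⟨ ∑-bound (λ j → count (atOffset j)) 1 (λ j → count-≤1 (atOffset j) (unique j)) ⟩
    ℓ * 1                                  ≡⟨ *-identityʳ ℓ ⟩
    ℓ                                      ∎
    where
    open ≤-Reasoning
    atOffset : Fin ℓ → Fin n → Bool
    atOffset j v = nearTop v ∧ (depth v ∸ dt ≡ᵇ toℕ j)
    by-offset : ∀ v → T (nearTop v) → ∃ λ j → T (atOffset j v)
    by-offset v h = fromℕ< offset<ℓ , ∧-intro h (≡⇒≡ᵇ _ _ (sym (toℕ-fromℕ< offset<ℓ)))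
      where
      offset<ℓ : depth v ∸ dt < ℓ
      offset<ℓ = <ᵇ⇒< _ ℓ (proj₁ (∧-elim (proj₂ (∧-elim {nonRoot v} h))))
    parts : ∀ {v} → T (nearTop v) → T (inS v) × T (unaryChain (depth v ∸ dt) v)
    parts {v} h = proj₁ (nonRoot⁻ (proj₁ (∧-elim h))) , proj₂ (∧-elim (proj₂ (∧-elim {nonRoot v} h)))
    unique : ∀ j v w → T (atOffset j v) → T (atOffset j w) → v ≡ w
    unique j v w hv hw with ∧-elim {nearTop v} hv | ∧-elim {nearTop w} hw
    ... | nv , ov | nw , ow = ancestor-injective-on-chains (depth v ∸ dt) v w (m∸n≤m (depth v) dt)
        (subst (_≤ depth w) (sym same) (m∸n≤m (depth w) dt))
        (unaryChain-children (proj₂ (parts nv)))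
        (trans (S-ancestorAt (proj₁ (parts nv))) (sym (trans (cong (λ k → ancestor k w) same) (S-ancestorAt (proj₁ (parts nw))))))
      where
      same : depth v ∸ dt ≡ depth w ∸ dt
      same = trans (≡ᵇ⇒≡ _ _ ov) (sym (≡ᵇ⇒≡ _ _ ow))

  count-belowBreak : ∀ m → count (belowBreak m) ≤ count belowNonUnary
  count-belowBreak m = count-injection (belowBreak m) belowNonUnary (ancestor m) maps injective
    where
    parts : ∀ {v} → T (belowBreak m v) →
      T (inS v) × T (nonUnary (ancestor (suc m) v)) × T (unaryChain m v) × dt < depth (ancestor m v)
    parts {v} h with ∧-elim {nonRoot v} h
    ... | nr , rest with ∧-elim {nonUnary (ancestor (suc m) v)} rest
    ... | break , rest′ with ∧-elim {unaryChain m v} rest′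
    ... | chain , deeper = proj₁ (nonRoot⁻ nr) , break , chain , <ᵇ⇒< dt _ deeper
    maps : ∀ v → T (belowBreak m v) → T (belowNonUnary (ancestor m v))
    maps v h with parts h
    ... | v∈S , break , _ , deeper = ∧-intro (∧-intro (S-ancestor m v∈S deeper) (<⇒<ᵇ deeper)) break
    m≤depth : ∀ {v} → dt < depth (ancestor m v) → m ≤ depth v
    m≤depth {v} deeper = ≮⇒≥ (λ dv<m → <⇒≱ deeper
      (subst (_≤ dt) (sym (trans (depth-ancestor m v) (m≤n⇒m∸n≡0 (<⇒≤ dv<m)))) z≤n))
    injective : ∀ v w → T (belowBreak m v) → T (belowBreak m w) → ancestor m v ≡ ancestor m w → v ≡ w
    injective v w hv hw e with parts hv | parts hw
    ... | _ , _ , chain , dv | _ , _ , _ , dw =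
      ancestor-injective-on-chains m v w (m≤depth dv) (m≤depth dw) (unaryChain-children chain) e

  count-S-≤ : count inS ≤ count (λ v → inS v ∧ startsBarePath v) + (1 + (ℓ + ℓ * count belowNonUnary))
  count-S-≤ = begin
    count inS
      ≡⟨ count-split inS startsBarePath ⟩
    count (λ v → inS v ∧ startsBarePath v) + count notBare
      ≤⟨ +-monoʳ-≤ _ (count-∪ notBare (_== r) rest (λ v h → root-or-rest v h)) ⟩
    count (λ v → inS v ∧ startsBarePath v) + (count (_== r) + count rest)
      ≤⟨ +-monoʳ-≤ _ (+-mono-≤ (≤-reflexive (count-== r)) (count-∪ rest nearTop (λ v → rest v ∧ not (nearTop v)) near-or-break)) ⟩
    count (λ v → inS v ∧ startsBarePath v) + (1 + (count nearTop + count (λ v → rest v ∧ not (nearTop v))))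
      ≤⟨ +-monoʳ-≤ _ (+-monoʳ-≤ 1 (+-mono-≤ count-nearTop (count-cover _ (λ j → belowBreak (toℕ j)) by-break))) ⟩
    count (λ v → inS v ∧ startsBarePath v) + (1 + (ℓ + ∑ (λ (j : Fin ℓ) → count (belowBreak (toℕ j)))))
      ≤⟨ +-monoʳ-≤ _ (+-monoʳ-≤ 1 (+-monoʳ-≤ ℓ (∑-bound {ℓ} (λ j → count (belowBreak (toℕ j))) (count belowNonUnary) (λ j → count-belowBreak (toℕ j))))) ⟩
    count (λ v → inS v ∧ startsBarePath v) + (1 + (ℓ + ℓ * count belowNonUnary)) ∎
    where
    open ≤-Reasoning
    notBare : Fin n → Bool
    notBare v = inS v ∧ not (startsBarePath v)
    rest : Fin n → Bool
    rest v = notBare v ∧ not (v == r)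
    root-or-rest : ∀ v → T (notBare v) → T (v == r) ⊎ T (rest v)
    root-or-rest v h with v == r
    ... | true = inj₁ tt
    ... | false = inj₂ (∧-intro h tt)
    near-or-break : ∀ v → T (rest v) → T (nearTop v) ⊎ T (rest v ∧ not (nearTop v))
    near-or-break v h with nearTop v
    ... | true = inj₁ tt
    ... | false = inj₂ (∧-intro h tt)
    by-break : ∀ v → T (rest v ∧ not (nearTop v)) → ∃ λ (j : Fin ℓ) → T (belowBreak (toℕ j) v)
    by-break v h with ∧-elim {rest v} h
    ... | rv , not-near with ∧-elim {notBare v} rv
    ... | nb , v≠r with ∧-elim {inS v} nb
    ... | v∈S , not-bare with classify v v∈S (not-elim not-bare)
    ... | inj₁ v≡r = ⊥-elim (not-elim v≠r (≡⇒== v≡r))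
    ... | inj₂ (inj₁ near) = ⊥-elim (not-elim not-near near)
    ... | inj₂ (inj₂ (m , m<ℓ , bb)) = fromℕ< m<ℓ , subst (λ k → T (belowBreak k v)) (sym (toℕ-fromℕ< m<ℓ)) bb

module Induced {n : ℕ} (tree : Tree n) (r : Fin n) where

  open import Data.Nat hiding (_≟_)
  open import Data.Nat.Properties hiding (_≟_)
  open import Data.Bool using (Bool; T; _∧_)
  open import Data.Fin using (_≟_)
  open import Data.Product using (_×_; proj₁; proj₂)
  open import Data.Empty using (⊥-elim)
  open import Relation.Nullary using (yes; no; Dec)
  open import Relation.Binary.PropositionalEquality
  open import Defs hiding (sym; Tree)
  open Counting
  open RootedTree tree r

  module _ (S : Fin n → Bool) (t : Fin n) (t∈S : T (S t))
           (S-up : ∀ v → T (S v) → v ≢ t → T (S (parent v)) × depth t < depth v) where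

    m : ℕ
    m = count S

    emb : Fin m → Fin n
    emb = enumerate S

    inducedGraph : Graph m
    inducedGraph = record
      { adj = λ i j → adj G (emb i) (emb j)
      ; sym = λ i j → Graph.sym G (emb i) (emb j)
      ; irrefl = λ i → Graph.irrefl G (emb i)
      }

    index : ∀ v → T (S v) → Fin m
    index v v∈S = proj₁ (enumerate-complete S v v∈S)

    emb-index : ∀ v (v∈S : T (S v)) → emb (index v v∈S) ≡ v
    emb-index v v∈S = proj₂ (enumerate-complete S v v∈S)

    walk-up : ∀ k i → depth (emb i) ∸ depth t ≡ k → Walk inducedGraph i (index t t∈S)
    walk-up k i e = by-cases (emb i ≟ t) k e
      where
      by-cases : Dec (emb i ≡ t) → ∀ k → depth (emb i) ∸ depth t ≡ k → Walk inducedGraph i (index t t∈S)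
      by-cases (yes i≡t) _ _ =
        subst (Walk inducedGraph i) (enumerate-injective S i _ (trans i≡t (sym (emb-index t t∈S)))) (here i)
      by-cases (no i≢t) zero e = ⊥-elim (<⇒≱ (proj₂ (S-up (emb i) (enumerate-sound S i) i≢t)) (m∸n≡0⇒m≤n e))
      by-cases (no i≢t) (suc k) e = step edge (walk-up k p depth-p)
        where
        v : Fin n
        v = emb i
        up : T (S (parent v)) × depth t < depth v
        up = S-up v (enumerate-sound S i) i≢t
        p : Fin m
        p = index (parent v) (proj₁ up)
        emb-p : emb p ≡ parent v
        emb-p = emb-index (parent v) (proj₁ up)
        edge : Edge inducedGraph i p
        edge = subst (v ~_) (sym emb-p) (~-sym (parent-~ v (0<depth⇒≢root (≤-trans (s≤s z≤n) (proj₂ up)))))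
        depth-p : depth (emb p) ∸ depth t ≡ k
        depth-p = begin
          depth (emb p) ∸ depth t        ≡⟨ cong (λ w → depth w ∸ depth t) emb-p ⟩
          depth (parent v) ∸ depth t     ≡⟨ cong (_∸ depth t) (depth-parent v) ⟩
          depth v ∸ 1 ∸ depth t          ≡⟨ ∸-+-assoc (depth v) 1 (depth t) ⟩
          depth v ∸ (1 + depth t)        ≡⟨ cong (depth v ∸_) (+-comm 1 (depth t)) ⟩
          depth v ∸ (depth t + 1)        ≡⟨ ∸-+-assoc (depth v) (depth t) 1 ⟨
          depth v ∸ depth t ∸ 1          ≡⟨ cong (_∸ 1) e ⟩
          k                              ∎
          where open ≡-Reasoning

    walk-++ : ∀ {a b c} → Walk inducedGraph a b → Walk inducedGraph b c → Walk inducedGraph a c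
    walk-++ (here _) w = w
    walk-++ (step e w₁) w = step e (walk-++ w₁ w)

    walk-reverse : ∀ {a b} → Walk inducedGraph a b → Walk inducedGraph b a
    walk-reverse (here a) = here a
    walk-reverse (step {u = a} {v = b} e w) =
      walk-++ (walk-reverse w) (step (subst T (Graph.sym inducedGraph a b) e) (here a))

    inducedTree : Tree m
    inducedTree = record
      { graph = inducedGraph
      ; connected = λ i j → walk-++ (walk-up _ i refl) (walk-reverse (walk-up _ j refl))
      ; acyclic = λ cycle → acyclic tree record
          { k = Cycle.k cycle
          ; c = λ x → emb (Cycle.c cycle x)
          ; inj = λ e → Cycle.inj cycle (enumerate-injective S _ _ e)
          ; edges = Cycle.edges cycle
          ; close = Cycle.close cycle
          }
      }

    inducedSubtree : Subtree G m
    inducedSubtree = record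
      { tree = inducedTree
      ; emb = emb
      ; inj = λ {i} {j} e → enumerate-injective S i j e
      ; hom = λ i j e → e
      }

    inducedSubtree-NL : count (λ u → S u ∧ inNbrLeaves G u) ≡ subtreeNL inducedSubtree
    inducedSubtree-NL = trans (count-∧-enumerate S (inNbrLeaves G))
                              (sym (countB-allFin (λ i → inNbrLeaves G (emb i))))

module Arithmetic where

  open import Data.Nat
  open import Data.Nat.Properties
  open import Data.Nat.Solver using (module +-*-Solver)
  open import Data.Nat.DivMod using (_/_; _%_; m≡m%n+[m/n]*n; m/n*n≤m; m%n<n)
  open import Relation.Binary.PropositionalEquality
  open +-*-Solver

  2*16^y+1≤2^[4y+2] : ∀ y → 2 * 16 ^ y + 1 ≤ 2 ^ (4 * y + 2)
  2*16^y+1≤2^[4y+2] y = begin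
    2 * 16 ^ y + 1               ≤⟨ +-monoʳ-≤ (2 * 16 ^ y) (≤-trans (m^n>0 16 y) (m≤m+n (16 ^ y) (16 ^ y))) ⟩
    2 * 16 ^ y + (16 ^ y + 16 ^ y) ≡⟨ solve 1 (λ a → con 2 :* a :+ (a :+ a) := a :* con 4) refl (16 ^ y) ⟩
    16 ^ y * 4                   ≡⟨ cong (_* 4) (^-*-assoc 2 4 y) ⟩
    2 ^ (4 * y) * 2 ^ 2          ≡⟨ ^-distribˡ-+-* 2 (4 * y) 2 ⟨
    2 ^ (4 * y + 2)              ∎
    where open ≤-Reasoning

  ^-cancelʳ-≤ : ∀ a b k → 1 ≤ k → a ^ k ≤ b ^ k → a ≤ b
  ^-cancelʳ-≤ a b (suc k) _ h = ≮⇒≥ (λ b<a → <⇒≱ (^-monoˡ-< (suc k) b<a) h)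

  2^-cancel-≤ : ∀ a b → 2 ^ a ≤ 2 ^ b → a ≤ b
  2^-cancel-≤ a b h = ≮⇒≥ (λ b<a → <⇒≱ (^-monoʳ-< 2 (s≤s (s≤s z≤n)) b<a) h)

  -- Compare Δ-th powers: (n^C)^Δ = (n^Δ)^C ≤ 2^(B C) ≤ 2^(h Δ).
  ^-≤-2^ : ∀ n C Δ B h → 1 ≤ Δ → n ^ Δ ≤ 2 ^ B → 2 * C * B + 2 * Δ ≤ Δ * (2 * h + 1) + Δ → n ^ C ≤ 2 ^ h
  ^-≤-2^ n C Δ B h 1≤Δ nΔ≤ budget = ^-cancelʳ-≤ (n ^ C) (2 ^ h) Δ 1≤Δ (begin
    (n ^ C) ^ Δ    ≡⟨ ^-*-assoc n C Δ ⟩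
    n ^ (C * Δ)    ≡⟨ cong (n ^_) (*-comm C Δ) ⟩
    n ^ (Δ * C)    ≡⟨ ^-*-assoc n Δ C ⟨
    (n ^ Δ) ^ C    ≤⟨ ^-monoˡ-≤ C nΔ≤ ⟩
    (2 ^ B) ^ C    ≡⟨ ^-*-assoc 2 B C ⟩
    2 ^ (B * C)    ≤⟨ ^-monoʳ-≤ 2 exponents ⟩
    2 ^ (h * Δ)    ≡⟨ ^-*-assoc 2 h Δ ⟨
    (2 ^ h) ^ Δ    ∎)
    where
    open ≤-Reasoning
    exponents : B * C ≤ h * Δ
    exponents = *-cancelˡ-≤ 2 (+-cancelʳ-≤ (2 * Δ) _ _ (begin
      2 * (B * C) + 2 * Δ               ≡⟨ cong (_+ 2 * Δ) (solve 2 (λ b c → con 2 :* (b :* c) := con 2 :* c :* b) refl B C) ⟩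
      2 * C * B + 2 * Δ                 ≤⟨ budget ⟩
      Δ * (2 * h + 1) + Δ               ≡⟨ solve 2 (λ d h → d :* (con 2 :* h :+ con 1) :+ d := con 2 :* (h :* d) :+ con 2 :* d) refl Δ h ⟩
      2 * (h * Δ) + 2 * Δ               ∎))

  *-/-≤ : ∀ n d .{{_ : NonZero d}} → d * (n / d) ≤ n
  *-/-≤ n d = ≤-trans (≤-reflexive (*-comm d (n / d))) (m/n*n≤m n d)

  <-*-/-+ : ∀ n d .{{_ : NonZero d}} → n < d * (n / d) + d
  <-*-/-+ n d = begin-strict
    n                      ≡⟨ m≡m%n+[m/n]*n n d ⟩
    n % d + n / d * d      ≡⟨ +-comm (n % d) _ ⟩
    n / d * d + n % d      <⟨ +-mono-≤-< (≤-reflexive (*-comm (n / d) d)) (m%n<n n d) ⟩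
    d * (n / d) + d        ∎
    where open ≤-Reasoning

  2*<-of-* : ∀ {A d n} → 4 ≤ d → d * A ≤ n → 2 ≤ n → 2 * A < n
  2*<-of-* {zero} _ _ 2≤n = ≤-trans (s≤s z≤n) 2≤n
  2*<-of-* {suc a} {d} {n} 4≤d dA≤n _ = <-≤-trans (*-monoˡ-< (suc a) {2} {4} (s≤s (s≤s (s≤s z≤n))))
                                                 (≤-trans (*-monoˡ-≤ (suc a) 4≤d) dA≤n)

  -- With δ ≥ 1/(q+1): D = 4(q+1) makes a piece of at most 3 (n / D) + 1 vertices smaller than δ n,
  -- and g, M, N₀ are large enough for the estimates below to close.
  module Constants (ℓ q C : ℕ) where

    K D E C₁ g M N₀ : ℕ
    K = suc ℓ
    D = 4 * suc q
    E = K * D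
    C₁ = suc C
    g = 8 * E * C₁
    M = 64 * E * C₁
    N₀ = 448 * E + 64 * D + M + 2

    module Estimates {n A bare Δ X Λ y : ℕ}
             (n-large : 448 * E + 64 * D + M ≤ n)
             (n≤DA+D : n ≤ D * A + D)
             (bare-few : g * bare ≤ K * n)
             (Δ≤ : Δ ≤ 4 * y + 2) (My≤ : M * y ≤ n + M)
             (piece≤ : A + 1 ≤ bare + (1 + (ℓ + ℓ * X)))
             (X≤ : X ≤ Δ + 2 * Λ) where

      open ≤-Reasoning

      private
        A≤ : A ≤ bare + K + K * Δ + 2 * K * Λ
        A≤ = begin
          A                          ≤⟨ +-cancelʳ-≤ 1 A _ (subst (A + 1 ≤_) (solve 3 (λ G l lX → G :+ (con 1 :+ (l :+ lX)) := G :+ l :+ lX :+ con 1) refl bare ℓ (ℓ * X)) piece≤) ⟩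
          bare + ℓ + ℓ * X           ≤⟨ +-mono-≤ (+-monoʳ-≤ bare (n≤1+n ℓ)) (*-mono-≤ (n≤1+n ℓ) X≤) ⟩
          bare + K + K * (Δ + 2 * Λ) ≡⟨ solve 4 (λ G k d l → G :+ k :+ k :* (d :+ con 2 :* l) := G :+ k :+ k :* d :+ con 2 :* k :* l) refl bare K Δ Λ ⟩
          bare + K + K * Δ + 2 * K * Λ ∎

        MA≤ : M * A ≤ 12 * K * n + 7 * K * M + 2 * K * M * Λ
        MA≤ = begin
          M * A
            ≤⟨ *-monoʳ-≤ M A≤ ⟩
          M * (bare + K + K * Δ + 2 * K * Λ)
            ≡⟨ solve 5 (λ m G k d l → m :* (G :+ k :+ k :* d :+ con 2 :* k :* l) := m :* G :+ m :* k :+ k :* (m :* d) :+ con 2 :* k :* m :* l) refl M bare K Δ Λ ⟩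
          M * bare + M * K + K * (M * Δ) + 2 * K * M * Λ
            ≤⟨ +-monoˡ-≤ (2 * K * M * Λ) (+-mono-≤ (+-monoˡ-≤ (M * K) M*bare≤) (*-monoʳ-≤ K M*Δ≤)) ⟩
          8 * (K * n) + M * K + K * (4 * (n + M) + 2 * M) + 2 * K * M * Λ
            ≡⟨ solve 4 (λ k n m l → con 8 :* (k :* n) :+ m :* k :+ k :* (con 4 :* (n :+ m) :+ con 2 :* m) :+ con 2 :* k :* m :* l
                                   := con 12 :* k :* n :+ con 7 :* k :* m :+ con 2 :* k :* m :* l) refl K n M Λ ⟩
          12 * K * n + 7 * K * M + 2 * K * M * Λ ∎
          where
          M*bare≤ : M * bare ≤ 8 * (K * n)
          M*bare≤ = begin
            M * bare       ≡⟨ solve 3 (λ e c G → con 64 :* e :* c :* G := con 8 :* (con 8 :* e :* c :* G)) refl E C₁ bare ⟩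
            8 * (g * bare) ≤⟨ *-monoʳ-≤ 8 bare-few ⟩
            8 * (K * n)    ∎
          M*Δ≤ : M * Δ ≤ 4 * (n + M) + 2 * M
          M*Δ≤ = begin
            M * Δ               ≤⟨ *-monoʳ-≤ M Δ≤ ⟩
            M * (4 * y + 2)     ≡⟨ solve 2 (λ m y → m :* (con 4 :* y :+ con 2) := con 4 :* (m :* y) :+ con 2 :* m) refl M y ⟩
            4 * (M * y) + 2 * M ≤⟨ +-monoˡ-≤ (2 * M) (*-monoʳ-≤ 4 My≤) ⟩
            4 * (n + M) + 2 * M ∎

        n≤ : 64 * C₁ * n ≤ 12 * n + 7 * M + 2 * M * Λ + 64 * C₁ * D
        n≤ = *-cancelˡ-≤ K (begin
          K * (64 * C₁ * n)
            ≡⟨ solve 3 (λ k c n → k :* (con 64 :* c :* n) := con 64 :* k :* c :* n) refl K C₁ n ⟩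
          64 * K * C₁ * n
            ≤⟨ *-monoʳ-≤ (64 * K * C₁) n≤DA+D ⟩
          64 * K * C₁ * (D * A + D)
            ≡⟨ solve 4 (λ k c d a → con 64 :* k :* c :* (d :* a :+ d) := con 64 :* (k :* d) :* c :* a :+ con 64 :* k :* c :* d) refl K C₁ D A ⟩
          M * A + 64 * K * C₁ * D
            ≤⟨ +-monoˡ-≤ (64 * K * C₁ * D) MA≤ ⟩
          12 * K * n + 7 * K * M + 2 * K * M * Λ + 64 * K * C₁ * D
            ≡⟨ solve 6 (λ k n m l c d → con 12 :* k :* n :+ con 7 :* k :* m :+ con 2 :* k :* m :* l :+ con 64 :* k :* c :* d
                                     := k :* (con 12 :* n :+ con 7 :* m :+ con 2 :* m :* l :+ con 64 :* c :* d)) refl K n M Λ C₁ D ⟩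
          K * (12 * n + 7 * M + 2 * M * Λ + 64 * C₁ * D) ∎)

        52n≤ : 52 * n ≤ 448 * E + 128 * E * Λ + 64 * D
        52n≤ = *-cancelˡ-≤ C₁ (+-cancelˡ-≤ (12 * n) _ _ (begin
          12 * n + C₁ * (52 * n)
            ≤⟨ +-monoˡ-≤ (C₁ * (52 * n)) (*-monoʳ-≤ 12 (m≤n*m n C₁)) ⟩
          12 * (C₁ * n) + C₁ * (52 * n)
            ≡⟨ solve 2 (λ c n → con 12 :* (c :* n) :+ c :* (con 52 :* n) := con 64 :* c :* n) refl C₁ n ⟩
          64 * C₁ * n
            ≤⟨ n≤ ⟩
          12 * n + 7 * M + 2 * M * Λ + 64 * C₁ * D
            ≡⟨ solve 5 (λ n e c l d → con 12 :* n :+ con 7 :* (con 64 :* e :* c) :+ con 2 :* (con 64 :* e :* c) :* l :+ con 64 :* c :* d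
                                   := con 12 :* n :+ c :* (con 448 :* e :+ con 128 :* e :* l :+ con 64 :* d)) refl n E C₁ Λ D ⟩
          12 * n + C₁ * (448 * E + 128 * E * Λ + 64 * D) ∎))

      many-leaves : 51 * n ≤ 128 * E * Λ
      many-leaves = +-cancelʳ-≤ n (51 * n) (128 * E * Λ) (begin
        51 * n + n                           ≡⟨ solve 1 (λ n → con 51 :* n :+ n := con 52 :* n) refl n ⟩
        52 * n                               ≤⟨ 52n≤ ⟩
        448 * E + 128 * E * Λ + 64 * D       ≡⟨ solve 3 (λ e l d → con 448 :* e :+ con 128 :* e :* l :+ con 64 :* d := con 128 :* e :* l :+ (con 448 :* e :+ con 64 :* d)) refl E Λ D ⟩
        128 * E * Λ + (448 * E + 64 * D)     ≤⟨ +-monoʳ-≤ (128 * E * Λ) (≤-trans (m≤m+n _ M) n-large) ⟩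
        128 * E * Λ + n                      ∎)

      C*n≤g*Λ : C * n ≤ g * Λ
      C*n≤g*Λ = *-cancelˡ-≤ 16 (begin
        16 * (C * n)         ≡⟨ *-assoc 16 C n ⟨
        16 * C * n           ≤⟨ *-monoˡ-≤ n (*-monoʳ-≤ 16 (n≤1+n C)) ⟩
        16 * C₁ * n          ≤⟨ *-monoˡ-≤ n (*-monoˡ-≤ C₁ (m≤m+n 16 35)) ⟩
        51 * C₁ * n          ≡⟨ solve 2 (λ c n → con 51 :* c :* n := c :* (con 51 :* n)) refl C₁ n ⟩
        C₁ * (51 * n)        ≤⟨ *-monoʳ-≤ C₁ many-leaves ⟩
        C₁ * (128 * E * Λ)   ≡⟨ solve 3 (λ c e l → c :* (con 128 :* e :* l) := con 16 :* (con 8 :* e :* c :* l)) refl C₁ E Λ ⟩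
        16 * (g * Λ)         ∎)

      log-budget : 2 * C * (4 * y + 2) + 2 * Δ ≤ Λ
      log-budget = *-cancelˡ-≤ M (≤-trans (*-monoʳ-≤ M lhs≤) (*-cancelˡ-≤ 2 (begin
        2 * (M * (2 * C₁ * (4 * y + 2)))
          ≡⟨ solve 3 (λ m c y → con 2 :* (m :* (con 2 :* c :* (con 4 :* y :+ con 2))) := con 4 :* c :* (con 4 :* (m :* y) :+ con 2 :* m)) refl M C₁ y ⟩
        4 * C₁ * (4 * (M * y) + 2 * M)
          ≤⟨ *-monoʳ-≤ (4 * C₁) (+-monoˡ-≤ (2 * M) (*-monoʳ-≤ 4 My≤)) ⟩
        4 * C₁ * (4 * (n + M) + 2 * M)
          ≤⟨ *-monoʳ-≤ (4 * C₁) (+-mono-≤ (*-monoʳ-≤ 4 (+-monoʳ-≤ n M≤n)) (*-monoʳ-≤ 2 M≤n)) ⟩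
        4 * C₁ * (4 * (n + n) + 2 * n)
          ≡⟨ solve 2 (λ c n → con 4 :* c :* (con 4 :* (n :+ n) :+ con 2 :* n) := c :* (con 40 :* n)) refl C₁ n ⟩
        C₁ * (40 * n)
          ≤⟨ *-monoʳ-≤ C₁ (*-monoˡ-≤ n (m≤m+n 40 11)) ⟩
        C₁ * (51 * n)
          ≤⟨ *-monoʳ-≤ C₁ many-leaves ⟩
        C₁ * (128 * E * Λ)
          ≡⟨ solve 3 (λ c e l → c :* (con 128 :* e :* l) := con 2 :* (con 64 :* e :* c :* l)) refl C₁ E Λ ⟩
        2 * (M * Λ) ∎)))
        where
        M≤n : M ≤ n
        M≤n = ≤-trans (m≤n+m M (448 * E + 64 * D)) n-large
        lhs≤ : 2 * C * (4 * y + 2) + 2 * Δ ≤ 2 * C₁ * (4 * y + 2)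
        lhs≤ = begin
          2 * C * (4 * y + 2) + 2 * Δ             ≤⟨ +-monoʳ-≤ (2 * C * (4 * y + 2)) (*-monoʳ-≤ 2 Δ≤) ⟩
          2 * C * (4 * y + 2) + 2 * (4 * y + 2)   ≡⟨ solve 2 (λ c y → con 2 :* c :* (con 4 :* y :+ con 2) :+ con 2 :* (con 4 :* y :+ con 2) := con 2 :* (con 1 :+ c) :* (con 4 :* y :+ con 2)) refl C y ⟩
          2 * C₁ * (4 * y + 2)                    ∎

module Dichotomy (ℓ q C : ℕ) where

  open import Data.Nat hiding (_≟_)
  open import Data.Nat.Properties hiding (_≟_)
  open import Data.Nat.DivMod using (_/_)
  open import Data.Nat.Solver using (module +-*-Solver)
  open import Data.Bool using (T; _∧_)
  open import Data.Fin using (Fin; fromℕ<)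
  open import Data.Fin.Properties using (any?)
  open import Data.Product using (Σ; ∃; _×_; _,_; proj₁; proj₂)
  open import Data.Sum using (_⊎_; inj₁; inj₂)
  open import Relation.Nullary using (yes; no; Dec)
  open import Data.Rational as ℚ using (ℚ; 0ℚ; 1ℚ) renaming (_≤_ to _≤ℚ_)
  open import Relation.Binary.PropositionalEquality
  open import Defs hiding (sym)
  open Counting
  open Rationals
  open Exponential
  open Arithmetic
  open Constants ℓ q C

  γ : ℚ
  γ = 1/suc (suc g)

  c : ℚ
  c = 1/suc (suc M)

  0<γ : 0ℚ ℚ.< γ
  0<γ = 1/suc-pos (suc g)

  γ<1 : γ ℚ.< 1ℚ
  γ<1 = 1/suc-<1 g

  0<c : 0ℚ ℚ.< c
  0<c = 1/suc-pos (suc M)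

  c<1 : c ℚ.< 1ℚ
  c<1 = 1/suc-<1 M

  ManyBarePaths : ∀ {n} → Tree n → Set
  ManyBarePaths {n} tree = ∃ λ k → (γ ℚ.* ℕ→ℚ n ≤ℚ ℕ→ℚ k) × DisjointBarePaths (graph tree) ℓ k

  LeafySubtree : ∀ {n} → Tree n → ℚ → Set
  LeafySubtree {n} tree δ =
    (ℕ→ℚ C ℚ.* γ ℚ.* ℕ→ℚ n ≤ℚ ℕ→ℚ (numLeaves (graph tree))) ×
    (∃ λ m → Σ (Subtree (graph tree) m) λ S → (ℕ→ℚ m ≤ℚ δ ℚ.* ℕ→ℚ n) × MulLogLe C n (ℕ→ℚ (subtreeNL S)))

  module _ (n : ℕ) (N₀≤n : N₀ ≤ n) (tree : Tree n) where

    n-large : 448 * E + 64 * D + M ≤ n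
    n-large = ≤-trans (m≤m+n (448 * E + 64 * D + M) 2) N₀≤n

    2≤n : 2 ≤ n
    2≤n = ≤-trans (m≤n+m 2 (448 * E + 64 * D + M)) N₀≤n

    D≤n : D ≤ n
    D≤n = ≤-trans (≤-trans (m≤m+n D (63 * D)) (m≤n+m (64 * D) (448 * E))) (≤-trans (m≤m+n (448 * E + 64 * D) M) n-large)

    root : Fin n
    root = fromℕ< (≤-trans (s≤s z≤n) 2≤n)

    open RootedTree tree root using (Δ; G)
    open BarePaths tree root ℓ using (startsBarePath; startsBarePathAt; startsBarePath-cover; disjointBarePaths)

    y : ℕ
    y = n / M + 1

    My≡ : M * y ≡ M * (n / M) + M
    My≡ = trans (*-distribˡ-+ M (n / M) 1) (cong (M * (n / M) +_) (*-identityʳ M))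

    Δ-bound : MulLogLe Δ n (c ℚ.* ℕ→ℚ n) → n ^ Δ ≤ 2 ^ (4 * y + 2)
    Δ-bound n^Δ≤e^cn = ≤-trans
      (LeExp⇒≤ (n ^ Δ) (c ℚ.* ℕ→ℚ n) y n^Δ≤e^cn (*-nonNeg (1/suc-nonNeg (suc M)) (ℕ→ℚ-nonNeg n))
        (1/suc-*-≤ (suc M) n y (≤-trans (<⇒≤ (<-*-/-+ n M)) (≤-trans (≤-reflexive (sym My≡))
                                        (*-monoˡ-≤ y (≤-trans (n≤1+n M) (n≤1+n (suc M))))))))
      (2*16^y+1≤2^[4y+2] y)

    module Leafy (n^Δ≤ : n ^ Δ ≤ 2 ^ (4 * y + 2))
                 (classes-small : ∀ ρ → g * count (startsBarePathAt ρ) ≤ n) where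

      A : ℕ
      A = n / D

      2A<n : 2 * A < n
      2A<n = 2*<-of-* (m≤m*n 4 (suc q)) (*-/-≤ n D) 2≤n

      open Pieces tree root
      open Piece (heavy A 2A<n) (J₀ A 2A<n)
      open NonBare tree root ℓ (heavy A 2A<n) (J₀ A 2A<n) using (count-S-≤)

      bare X Λ W h : ℕ
      bare = count (λ v → inS v ∧ startsBarePath v)
      X = count belowNonUnary
      Λ = count leafBelow
      W = count leafParent
      h = W / 2

      bare-few : g * bare ≤ K * n
      bare-few = begin
        g * bare                                      ≤⟨ *-monoʳ-≤ g (count-mono {n} {λ v → inS v ∧ startsBarePath v} {startsBarePath} (λ v h → proj₂ (∧-elim {inS v} h))) ⟩
        g * count startsBarePath                      ≤⟨ *-monoʳ-≤ g startsBarePath-cover ⟩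
        g * ∑ (λ ρ → count (startsBarePathAt ρ))      ≡⟨ ∑-*ˡ g (λ ρ → count (startsBarePathAt ρ)) ⟨
        ∑ (λ ρ → g * count (startsBarePathAt ρ))      ≤⟨ ∑-bound (λ ρ → g * count (startsBarePathAt ρ)) n classes-small ⟩
        K * n                                         ∎
        where open ≤-Reasoning

      Δ≤ : Δ ≤ 4 * y + 2
      Δ≤ = 2^-cancel-≤ Δ (4 * y + 2) (≤-trans (^-monoˡ-≤ Δ 2≤n) n^Δ≤)

      piece≤ : A + 1 ≤ bare + (1 + (ℓ + ℓ * X))
      piece≤ = ≤-trans (proj₁ (piece-size A 2A<n)) count-S-≤

      open Estimates {n} {A} {bare} {Δ} {X} {Λ} {y} n-large (<⇒≤ (<-*-/-+ n D)) bare-few Δ≤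
             (≤-trans (≤-reflexive My≡) (+-monoˡ-≤ M (*-/-≤ n M))) piece≤ count-belowNonUnary

      leaves : ℕ→ℚ C ℚ.* γ ℚ.* ℕ→ℚ n ≤ℚ ℕ→ℚ (numLeaves G)
      leaves = *-1/suc-*-≤ C (suc g) n (numLeaves G)
        (≤-trans C*n≤g*Λ (*-mono-≤ (≤-trans (n≤1+n g) (n≤1+n (suc g))) count-leafBelow-≤-numLeaves))

      piece-small : ℕ→ℚ (count inS) ≤ℚ 1/suc q ℚ.* ℕ→ℚ n
      piece-small = ≤-1/suc-* q n (count inS) (*-cancelˡ-≤ 4 (begin
        4 * (suc q * count inS)    ≡⟨ *-assoc 4 (suc q) (count inS) ⟨
        D * count inS              ≤⟨ *-monoʳ-≤ D (proj₂ (piece-size A 2A<n)) ⟩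
        D * (3 * A + 1)            ≡⟨ solve 2 (λ d a → d :* (con 3 :* a :+ con 1) := con 3 :* (d :* a) :+ d) refl D A ⟩
        3 * (D * A) + D            ≤⟨ +-mono-≤ (*-monoʳ-≤ 3 (*-/-≤ n D)) D≤n ⟩
        3 * n + n                  ≡⟨ +-comm (3 * n) n ⟩
        4 * n                      ∎))
        where
        open ≤-Reasoning
        open +-*-Solver

      S-up : ∀ v → T (inS v) → v ≢ heavy A 2A<n → T (inS (RootedTree.parent tree root v)) × dt < RootedTree.depth tree root v
      S-up v v∈S v≢t = S-parent v∈S v≢t , S-depth v∈S v≢t

      subtree : Subtree G (count inS)
      subtree = Induced.inducedSubtree tree root inS (heavy A 2A<n) t∈S S-up

      1≤Λ : 1 ≤ Λ
      1≤Λ = n≢0⇒n>0 (λ Λ≡0 → <⇒≱ (*-monoʳ-< 51 {0} {n} (≤-trans (s≤s z≤n) 2≤n))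
                       (≤-trans many-leaves (≤-reflexive (trans (cong (128 * E *_) Λ≡0) (*-zeroʳ (128 * E))))))

      1≤Δ : 1 ≤ Δ
      1≤Δ = n≢0⇒n>0 (λ Δ≡0 → <⇒≱ 1≤Λ (≤-trans count-leafBelow (≤-reflexive (subst (λ d → d * W + d ≡ 0) (sym Δ≡0) refl))))

      n^C≤2^h : n ^ C ≤ 2 ^ h
      n^C≤2^h = ^-≤-2^ n C Δ (4 * y + 2) h 1≤Δ n^Δ≤
        (≤-trans log-budget (≤-trans count-leafBelow (+-monoˡ-≤ Δ (*-monoʳ-≤ Δ W≤2h+1))))
        where
        W≤2h+1 : W ≤ 2 * h + 1
        W≤2h+1 = ≤-pred (subst (W <_) (+-suc (2 * h) 1) (<-*-/-+ W 2))

      log : MulLogLe C n (ℕ→ℚ (subtreeNL subtree))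
      log = ≤⇒LeExp (n ^ C) h (subtreeNL subtree) n^C≤2^h
        (≤-trans (*-/-≤ W 2) (≤-reflexive (Induced.inducedSubtree-NL tree root inS (heavy A 2A<n) t∈S S-up)))

      leafySubtree : LeafySubtree tree (1/suc q)
      leafySubtree = leaves , count inS , subtree , piece-small , log

    dichotomy : n ^ Δ ≤ 2 ^ (4 * y + 2) → ManyBarePaths tree ⊎ LeafySubtree tree (1/suc q)
    dichotomy n^Δ≤ = by-cases (any? (λ ρ → n ≤? suc (suc g) * count (startsBarePathAt ρ)))
      where
      by-cases : Dec (∃ λ ρ → n ≤ suc (suc g) * count (startsBarePathAt ρ)) →
                 ManyBarePaths tree ⊎ LeafySubtree tree (1/suc q)
      by-cases (yes (ρ , big)) = inj₁ (count (startsBarePathAt ρ) ,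
        1/suc-*-≤ (suc g) n (count (startsBarePathAt ρ)) big , disjointBarePaths ρ)
      by-cases (no none) = inj₂ (Leafy.leafySubtree n^Δ≤ small)
        where
        small : ∀ ρ → g * count (startsBarePathAt ρ) ≤ n
        small ρ = ≤-trans (*-monoˡ-≤ (count (startsBarePathAt ρ)) (≤-trans (n≤1+n g) (n≤1+n (suc g))))
                          (<⇒≤ (≰⇒> (λ big → none (ρ , big))))

open Defs
open import Data.Nat using (ℕ; _≤_; _^_)
open import Data.Rational using (ℚ; _<_; _*_; 0ℚ; 1ℚ) renaming (_≤_ to _≤ℚ_)
open import Data.Product using (Σ; ∃; _×_; _,_)
open import Data.Sum using (_⊎_)
import Data.Sum as Sum
import Data.Rational.Properties as ℚP
open Rationals using (1/suc; 1/suc-≤-pos; *-ℕ→ℚ-monoˡ-≤)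

-- Only δ ≥ 1/(q+1) is used.
lemma2p14 : (ℓ : ℕ) (δ : ℚ) → 0ℚ < δ → δ < 1ℚ → (C : ℕ) →
    Σ ℚ λ γ → Σ ℚ λ c → (0ℚ < γ) × (γ < 1ℚ) × (0ℚ < c) × (c < 1ℚ) ×
    ∃ λ N → ∀ (n : ℕ) → N ≤ n → (T : Tree n) →
    MulLogLe (maxDegree (graph T)) n (c * ℕ→ℚ n) →
    (∃ λ k → (γ * ℕ→ℚ n ≤ℚ ℕ→ℚ k) × DisjointBarePaths (graph T) ℓ k)
    ⊎ ((ℕ→ℚ C * γ * ℕ→ℚ n ≤ℚ ℕ→ℚ (numLeaves (graph T))) ×
    (∃ λ m → Σ (Subtree (graph T) m) λ S →
    (ℕ→ℚ m ≤ℚ δ * ℕ→ℚ n) × MulLogLe C n (ℕ→ℚ (subtreeNL S))))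
lemma2p14 ℓ δ 0<δ _ C with 1/suc-≤-pos δ 0<δ
... | q , 1/suc-q≤δ = γ , c , 0<γ , γ<1 , 0<c , c<1 , N₀ ,
  λ n N₀≤n T n^Δ≤e^cn → Sum.map₂ (shrink n {T}) (dichotomy n N₀≤n T (Δ-bound n N₀≤n T n^Δ≤e^cn))
  where
  open Dichotomy ℓ q C
  open Arithmetic.Constants ℓ q C using (N₀)
  shrink : ∀ n {T : Tree n} → LeafySubtree T (1/suc q) → LeafySubtree T δ
  shrink n (leaves , m , S , m≤ , log) = leaves , m , S , ℚP.≤-trans m≤ (*-ℕ→ℚ-monoˡ-≤ n 1/suc-q≤δ) , log
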